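{- Let $q$ be a prime power and let $p(x)\in \mathbb{F}_q[x]$ be a monic irreducible polynomial of degree $k\geq 1$ with $p(1)\neq 0$. Let $m=q^k-1$ and define the rational function $g(x)=\dfrac{x^m-1}{(x-1)\,p(x)}$. Then $p(x)$ is primitive if and only if $g(x)$ is a polynomial with exactly $(q-1)q^{k-1}-1$ nonzero coefficients.
   Context: $\mathbb{F}_q$ denotes the finite field with $q$ elements. A polynomial $p(x)\in\mathbb{F}_q[x]$ of degree $k$ is called primitive if it is irreducible over $\mathbb{F}_q$, $p(0)\neq 0$, and a root of $p(x)$ in $\mathbb{F}_{q^k}$ has multiplicative order $q^k-1$, i.e. generates the cyclic group $\mathbb{F}_{q^k}^*$. The number of nonzero terms of a polynomial means the number of its nonzero coefficients. -}

module Defs where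

open import Level using (0ℓ)
open import Data.Nat as ℕ using (ℕ; zero; suc; _≤_; _<_)
open import Data.Nat.Primality using (Prime)
open import Data.Fin using (Fin)
open import Data.List using (List; []; _∷_; _++_; [_]; length; filter; replicate; map; foldr)
open import Data.Vec using (Vec; toList)
open import Data.Product using (Σ; ∃; _×_; _,_)
open import Data.Sum using (_⊎_)
open import Function.Bundles using (_↔_)
open import Relation.Nullary using (¬_; ¬?)
open import Relation.Binary.PropositionalEquality using (_≡_; _≢_)
open import Relation.Binary.Definitions using (DecidableEquality)
open import Algebra.Core using (Op₁; Op₂)
open import Algebra.Structures using (IsCommutativeRing)

IsPrimePower : ℕ → Set
IsPrimePower q = Σ ℕ λ ℓ → Σ ℕ λ e → Prime ℓ × 1 ≤ e × q ≡ ℓ ℕ.^ e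

record FiniteField (q : ℕ) : Set₁ where
  infixl 6 _+_
  infixl 7 _*_
  field
    Carrier    : Set
    _+_ _*_    : Op₂ Carrier
    -_         : Op₁ Carrier
    0# 1#      : Carrier
    isCommRing : IsCommutativeRing _≡_ _+_ _*_ -_ 0# 1#
    0≢1        : 0# ≢ 1#
    inverse    : ∀ x → x ≢ 0# → ∃ λ y → x * y ≡ 1#
    _≟_        : DecidableEquality Carrier
    card       : Carrier ↔ Fin q

-- Polynomials over F: coefficient lists, lowest degree first
-- (trailing zeros allowed; equality is coefficientwise).
module _ {q : ℕ} (F : FiniteField q) where
  open FiniteField F

  Poly : Set
  Poly = List Carrier

  coeff : Poly → ℕ → Carrier
  coeff []      _       = 0#
  coeff (a ∷ f) zero    = a
  coeff (a ∷ f) (suc n) = coeff f n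

  _≈P_ : Poly → Poly → Set
  f ≈P g = ∀ n → coeff f n ≡ coeff g n

  addP : Poly → Poly → Poly
  addP []      g       = g
  addP (a ∷ f) []      = a ∷ f
  addP (a ∷ f) (b ∷ g) = (a + b) ∷ addP f g

  mulP : Poly → Poly → Poly
  mulP []      g = []
  mulP (a ∷ f) g = addP (map (a *_) g) (0# ∷ mulP f g)

  eval : Poly → Carrier → Carrier
  eval f α = foldr (λ a acc → a + α * acc) 0# f

  weight : Poly → ℕ
  weight f = length (filter (λ a → ¬? (a ≟ 0#)) f)

  IsConstant : Poly → Set
  IsConstant f = ∀ n → 1 ≤ n → coeff f n ≡ 0#

  Irreducible : Poly → Set
  Irreducible p = ¬ IsConstant p × (∀ a b → mulP a b ≈P p → IsConstant a ⊎ IsConstant b)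

  monicPoly : ∀ {k} → Vec Carrier k → Poly
  monicPoly c = toList c ++ [ 1# ]

  xᵐ-1 : ℕ → Poly
  xᵐ-1 m = addP (replicate m 0# ++ [ 1# ]) [ - 1# ]

  x-1 : Poly
  x-1 = (- 1#) ∷ 1# ∷ []

pow : ∀ {q} (E : FiniteField q) → FiniteField.Carrier E → ℕ → FiniteField.Carrier E
pow E α zero    = FiniteField.1# E
pow E α (suc n) = FiniteField._*_ E α (pow E α n)

record IsFieldHom {q r} (F : FiniteField q) (E : FiniteField r)
                  (ι : FiniteField.Carrier F → FiniteField.Carrier E) : Set where
  module F = FiniteField F
  module E = FiniteField E
  field
    hom-1 : ι F.1# ≡ E.1#
    hom-+ : ∀ a b → ι (a F.+ b) ≡ ι a E.+ ι b
    hom-* : ∀ a b → ι (a F.* b) ≡ ι a E.* ι b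

HasOrder : ∀ {r} (E : FiniteField r) → FiniteField.Carrier E → ℕ → Set
HasOrder E α m = pow E α m ≡ FiniteField.1# E
               × (∀ j → 1 ≤ j → j < m → pow E α j ≢ FiniteField.1# E)

Primitive : ∀ {q} (F : FiniteField q) (k : ℕ) → Poly F → Set₁
Primitive {q} F k p =
  Irreducible F p × coeff F p 0 ≢ FiniteField.0# F ×
  Σ (FiniteField (q ℕ.^ k)) λ E →
  Σ (FiniteField.Carrier F → FiniteField.Carrier E) λ ι →
  IsFieldHom F E ι ×
  Σ (FiniteField.Carrier E) λ α →
    eval E (map ι p) α ≡ FiniteField.0# E × HasOrder E α (q ℕ.^ k ℕ.∸ 1)

module Submission where

-- Let p be monic irreducible of degree k over F = F_q with p(1) ≠ 0, and let R
-- be F[x]/(p), realised on coordinate vectors F^k, with α the class of x.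
-- Dividing the geometric series G_j = 1 + x + ... + x^(j-1) by p step by step,
-- the remainders W_j satisfy x·W_j + 1 = W_j + α^j, and the quotient of G_(j+1)
-- is that of G_j with the new constant term t_j = top coefficient of W_j.
-- Evaluating at 1 gives t_j·p(1) + α^j(1) = 1, where v(1) (valueAt1) is the
-- value at 1 of the representative of v; since p(1) ≠ 0, t_j ≠ 0 iff
-- α^j(1) ≠ 1, so the quotient of G_m has weight #{ j < m | α^j(1) ≠ 1 },
-- while exactly q^(k-1) vectors of F^k have value 1 at 1.
--   (⇒) If α has order m, the α^j (j < m) are the m nonzero vectors, so the
--       weight is m - q^(k-1); moreover W_m = 0, so p·(quotient) = G_m.
--   (⇐) If g exists then p·g = G_m, g is the quotient, W_m = 0 and α^m = 1;
--       the order d of α divides m and #{j < m | α^j(1) = 1} = (m/d)·(count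
--       below d) = q^(k-1), so m/d divides q^(k-1) and q^k - 1, hence d = m.
-- R is a field because, p being irreducible, no nonzero polynomial of degree
-- < k annihilates a nonzero element of an F[x]-module killed by p; this also
-- embeds R into every extension containing a root of p.

open import Defs
open import Level using (0ℓ)
open import Data.Nat as ℕ using (ℕ; zero; suc; z≤n; s≤s)
import Data.Nat.Properties as ℕₚ
import Data.Nat.DivMod as ℕ
import Data.Nat.Divisibility as ℕ
open import Data.Nat.Primality using (prime⇒nonTrivial)
open import Data.Fin using (Fin)
open import Data.Fin.Properties using (*↔×; 1↔⊤)
open import Data.Vec as Vec using (Vec; []; _∷_; toList)
open import Data.Vec.Properties using (≡-dec; ∷-injectiveˡ; ∷-injectiveʳ; length-toList)
open import Data.List using (List; []; _∷_; _++_; [_]; length; filter; replicate; map; allFin; cartesianProductWith)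
import Data.List.Properties as Listₚ
open import Data.List.Membership.Propositional using (_∈_; _∉_)
open import Data.List.Membership.Propositional.Properties using (∈-filter⁺; ∈-filter⁻; ∈-map⁺; ∈-map⁻; ∈-allFin; ∈-cartesianProductWith⁺)
open import Data.List.Relation.Unary.Any using (here; there)
import Data.List.Relation.Unary.Any as Any
import Data.List.Relation.Unary.All as All
import Data.List.Relation.Unary.AllPairs as AllPairs
open import Data.List.Relation.Unary.Unique.Propositional using (Unique)
import Data.List.Relation.Unary.Unique.Propositional.Properties as Unique
open import Data.Product using (Σ; ∃; _×_; _,_; proj₁; proj₂)
open import Data.Product.Function.NonDependent.Propositional using (_×-↔_)
open import Data.Sum using (_⊎_; inj₁; inj₂)
open import Data.Empty using (⊥; ⊥-elim)
open import Data.Unit using (tt)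
open import Data.Maybe using (Maybe; nothing; just)
open import Function.Bundles using (Inverse; _↔_; _⇔_; mk⇔; mk↔ₛ′)
open import Function.Properties.Inverse using (↔-sym; ↔-trans)
open import Relation.Nullary using (¬_; Dec; yes; no; ¬?)
open import Relation.Unary using (Pred; Decidable)
open import Relation.Binary.Definitions using (DecidableEquality; tri<; tri≈; tri>)
open import Relation.Binary.PropositionalEquality hiding ([_])
open import Algebra.Bundles using (CommutativeRing)
open import Algebra.Structures using (IsCommutativeRing)
import Algebra.Properties.Ring as RingProperties
import Algebra.Properties.Semiring.Mult as SemiringMult
import Algebra.Solver.Ring.NaturalCoefficients as NaturalCoefficients

-- The main fact is a pigeonhole principle: a
-- duplicate-free list L contained in M and as long as M has the same counts
-- as M for every predicate, and in particular contains every member of M.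
module ListCounting {A : Set} (_≟_ : DecidableEquality A) where

  count : {P : Pred A 0ℓ} → Decidable P → List A → ℕ
  count P? xs = length (filter P? xs)

  count-split : ∀ {P : Pred A 0ℓ} (P? : Decidable P) xs →
                length xs ≡ count P? xs ℕ.+ count (λ x → ¬? (P? x)) xs
  count-split P? [] = refl
  count-split P? (x ∷ xs) with P? x
  ... | yes _ = cong suc (count-split P? xs)
  ... | no  _ = trans (cong suc (count-split P? xs)) (sym (ℕₚ.+-suc _ _))

  count-absent : ∀ y xs → y ∉ xs → count (_≟ y) xs ≡ 0
  count-absent y [] _ = refl
  count-absent y (x ∷ xs) y∉ with x ≟ y
  ... | yes refl = ⊥-elim (y∉ (here refl))
  ... | no  _    = count-absent y xs (λ y∈ → y∉ (there y∈))

  count-unique : ∀ y xs → Unique xs → count (_≟ y) xs ℕ.≤ 1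
  count-unique y [] _ = z≤n
  count-unique y (x ∷ xs) (x∉xs AllPairs.∷ u) with x ≟ y
  ... | yes refl = s≤s (ℕₚ.≤-reflexive (count-absent y xs (λ y∈ → All.lookup x∉xs y∈ refl)))
  ... | no  _    = count-unique y xs u

  count-once : ∀ y xs → Unique xs → y ∈ xs → count (_≟ y) xs ≡ 1
  count-once y xs u y∈ =
    ℕₚ.≤-antisym (count-unique y xs u) (Listₚ.filter-some (_≟ y) (Any.map sym y∈))

  unique-⊆⇒length≤ : ∀ (L M : List A) → Unique L → (∀ {x} → x ∈ L → x ∈ M) → length L ℕ.≤ length M
  unique-⊆⇒length≤ [] M _ _ = z≤n
  unique-⊆⇒length≤ (x ∷ L) [] _ L⊆M with L⊆M (here refl)
  ... | ()
  unique-⊆⇒length≤ L (y ∷ M) u L⊆M = begin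
    length L                                   ≡⟨ count-split (_≟ y) L ⟩
    count (_≟ y) L ℕ.+ length L-y              ≤⟨ ℕₚ.+-mono-≤ (count-unique y L u)
                                                    (unique-⊆⇒length≤ L-y M (Unique.filter⁺ _ u) L-y⊆M) ⟩
    suc (length M)                             ∎
    where
    open ℕₚ.≤-Reasoning
    L-y : List A
    L-y = filter (λ x → ¬? (x ≟ y)) L
    L-y⊆M : ∀ {x} → x ∈ L-y → x ∈ M
    L-y⊆M x∈ with ∈-filter⁻ (λ x → ¬? (x ≟ y)) x∈
    ... | x∈L , x≢y with L⊆M x∈L
    ... | here x≡y = ⊥-elim (x≢y x≡y)
    ... | there x∈M = x∈M

  module Pigeonhole (L M : List A) (uL : Unique L) (L⊆M : ∀ {x} → x ∈ L → x ∈ M)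
                    (|L|≡|M| : length L ≡ length M) where

    count-≤ : ∀ {P : Pred A 0ℓ} (P? : Decidable P) → count P? L ℕ.≤ count P? M
    count-≤ P? = unique-⊆⇒length≤ (filter P? L) (filter P? M) (Unique.filter⁺ P? uL)
      (λ x∈ → let (x∈L , Px) = ∈-filter⁻ P? x∈ in ∈-filter⁺ P? (L⊆M x∈L) Px)

    -- both counts can only grow from L to M, and they add up to the same length
    count-≡ : ∀ {P : Pred A 0ℓ} (P? : Decidable P) → count P? L ≡ count P? M
    count-≡ P? with ℕₚ.m≤n⇒m<n∨m≡n (count-≤ P?)
    ... | inj₂ eq = eq
    ... | inj₁ lt = ⊥-elim (ℕₚ.<⇒≢ (ℕₚ.+-mono-<-≤ lt (count-≤ (λ x → ¬? (P? x)))) (begin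
      count P? L ℕ.+ count (λ x → ¬? (P? x)) L ≡⟨ sym (count-split P? L) ⟩
      length L                                 ≡⟨ |L|≡|M| ⟩
      length M                                 ≡⟨ count-split P? M ⟩
      count P? M ℕ.+ count (λ x → ¬? (P? x)) M ∎))
      where open ≡-Reasoning

    ⊇ : ∀ {y} → y ∈ M → y ∈ L
    ⊇ {y} y∈M with filter (_≟ y) L in eq
    ... | z ∷ _ = let (z∈L , z≡y) = ∈-filter⁻ (_≟ y) (subst (z ∈_) (sym eq) (here refl)) in subst (_∈ L) z≡y z∈L
    ... | []    = ⊥-elim (ℕₚ.<-irrefl refl (subst (0 ℕ.<_)
                    (trans (sym (count-≡ (_≟ y))) (cong length eq))
                    (Listₚ.filter-some (_≟ y) (Any.map sym y∈M))))

  count-filter : ∀ {P Q : Pred A 0ℓ} (P? : Decidable P) (Q? : Decidable Q) → (∀ x → P x → Q x) →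
                 ∀ xs → count P? (filter Q? xs) ≡ count P? xs
  count-filter P? Q? P⇒Q [] = refl
  count-filter P? Q? P⇒Q (x ∷ xs) with Q? x
  ... | yes _ with P? x
  ...   | yes _ = cong suc (count-filter P? Q? P⇒Q xs)
  ...   | no  _ = count-filter P? Q? P⇒Q xs
  count-filter P? Q? P⇒Q (x ∷ xs) | no ¬Qx with P? x
  ...   | yes Px = ⊥-elim (¬Qx (P⇒Q x Px))
  ...   | no  _  = count-filter P? Q? P⇒Q xs

module CountBelow where

  indicator : ∀ {X : Set} → Dec X → ℕ
  indicator (yes _) = 1
  indicator (no _)  = 0

  indicator-cong : ∀ {X Y : Set} (X? : Dec X) (Y? : Dec Y) → (X → Y) → (Y → X) → indicator X? ≡ indicator Y?
  indicator-cong (yes _) (yes _) _ _ = refl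
  indicator-cong (yes x) (no ¬y) f _ = ⊥-elim (¬y (f x))
  indicator-cong (no ¬x) (yes y) _ g = ⊥-elim (¬x (g y))
  indicator-cong (no _)  (no _)  _ _ = refl

  countBelow : {P : Pred ℕ 0ℓ} → (∀ i → Dec (P i)) → ℕ → ℕ
  countBelow P? zero    = 0
  countBelow P? (suc n) = indicator (P? n) ℕ.+ countBelow P? n

  countBelow-cong : ∀ {P Q : Pred ℕ 0ℓ} (P? : ∀ i → Dec (P i)) (Q? : ∀ i → Dec (Q i)) →
                    (∀ i → P i → Q i) → (∀ i → Q i → P i) → ∀ n → countBelow P? n ≡ countBelow Q? n
  countBelow-cong P? Q? f g zero    = refl
  countBelow-cong P? Q? f g (suc n) =
    cong₂ ℕ._+_ (indicator-cong (P? n) (Q? n) (f n) (g n)) (countBelow-cong P? Q? f g n)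

  countBelow-split : ∀ {P : Pred ℕ 0ℓ} (P? : ∀ i → Dec (P i)) n →
                     countBelow P? n ℕ.+ countBelow (λ i → ¬? (P? i)) n ≡ n
  countBelow-split P? zero = refl
  countBelow-split P? (suc n) with P? n
  ... | yes _ = cong suc (countBelow-split P? n)
  ... | no  _ = trans (ℕₚ.+-suc _ _) (cong suc (countBelow-split P? n))

  countBelow-+ : ∀ {P : Pred ℕ 0ℓ} (P? : ∀ i → Dec (P i)) a b →
                 countBelow P? (b ℕ.+ a) ≡ countBelow P? a ℕ.+ countBelow (λ i → P? (a ℕ.+ i)) b
  countBelow-+ P? a zero = sym (ℕₚ.+-identityʳ _)
  countBelow-+ {P} P? a (suc b) = begin
    indicator (P? (b ℕ.+ a)) ℕ.+ countBelow P? (b ℕ.+ a)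
      ≡⟨ cong₂ ℕ._+_ (indicator-cong (P? (b ℕ.+ a)) (P? (a ℕ.+ b)) (subst P (ℕₚ.+-comm b a)) (subst P (ℕₚ.+-comm a b)))
                     (countBelow-+ P? a b) ⟩
    x ℕ.+ (countBelow P? a ℕ.+ y)   ≡⟨ sym (ℕₚ.+-assoc x _ y) ⟩
    x ℕ.+ countBelow P? a ℕ.+ y     ≡⟨ cong (ℕ._+ y) (ℕₚ.+-comm x _) ⟩
    countBelow P? a ℕ.+ x ℕ.+ y     ≡⟨ ℕₚ.+-assoc _ x y ⟩
    countBelow P? a ℕ.+ (x ℕ.+ y)   ∎
    where
    open ≡-Reasoning
    x = indicator (P? (a ℕ.+ b))
    y = countBelow (λ i → P? (a ℕ.+ i)) b

  countBelow-periodic : ∀ {P : Pred ℕ 0ℓ} (P? : ∀ i → Dec (P i)) d →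
                        (∀ i → P i → P (d ℕ.+ i)) → (∀ i → P (d ℕ.+ i) → P i) →
                        ∀ t → countBelow P? (t ℕ.* d) ≡ t ℕ.* countBelow P? d
  countBelow-periodic P? d f g zero = refl
  countBelow-periodic {P} P? d f g (suc t) = begin
    countBelow P? (d ℕ.+ t ℕ.* d)
      ≡⟨ countBelow-+ P? (t ℕ.* d) d ⟩
    countBelow P? (t ℕ.* d) ℕ.+ countBelow (λ i → P? (t ℕ.* d ℕ.+ i)) d
      ≡⟨ cong₂ ℕ._+_ (countBelow-periodic P? d f g t) (countBelow-cong _ P? (shift⇒ t) (shift⇐ t) d) ⟩
    t ℕ.* countBelow P? d ℕ.+ countBelow P? d
      ≡⟨ ℕₚ.+-comm (t ℕ.* countBelow P? d) _ ⟩
    suc t ℕ.* countBelow P? d ∎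
    where
    open ≡-Reasoning
    shift⇒ : ∀ t i → P (t ℕ.* d ℕ.+ i) → P i
    shift⇒ zero    i x = x
    shift⇒ (suc t) i x = shift⇒ t i (g (t ℕ.* d ℕ.+ i) (subst P (ℕₚ.+-assoc d (t ℕ.* d) i) x))
    shift⇐ : ∀ t i → P i → P (t ℕ.* d ℕ.+ i)
    shift⇐ zero    i x = x
    shift⇐ (suc t) i x = subst P (sym (ℕₚ.+-assoc d (t ℕ.* d) i)) (f _ (shift⇐ t i x))

open CountBelow

module Iteration {X : Set} (S : X → X) (x₀ : X) where

  iterate : ℕ → X
  iterate zero    = x₀
  iterate (suc j) = S (iterate j)

  module Period {d : ℕ} (return : iterate d ≡ x₀) where
    periodic : ∀ i → iterate (d ℕ.+ i) ≡ iterate i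
    periodic zero    = trans (cong iterate (ℕₚ.+-identityʳ d)) return
    periodic (suc i) = trans (cong iterate (ℕₚ.+-suc d i)) (cong S (periodic i))

    periodic* : ∀ t r → iterate (t ℕ.* d ℕ.+ r) ≡ iterate r
    periodic* zero    r = refl
    periodic* (suc t) r = trans (cong iterate (ℕₚ.+-assoc d (t ℕ.* d) r)) (trans (periodic (t ℕ.* d ℕ.+ r)) (periodic* t r))

  Returns : ℕ → Set
  Returns d = iterate d ≡ x₀

  NoReturnBelow : ℕ → Set
  NoReturnBelow d = ∀ d′ → 1 ℕ.≤ d′ → d′ ℕ.< d → ¬ Returns d′

  first-return : (∀ j → Dec (Returns j)) → ∀ b →
                 NoReturnBelow b ⊎ (Σ ℕ λ d → 1 ℕ.≤ d × d ℕ.< b × Returns d × NoReturnBelow d)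
  first-return returns? zero = inj₁ (λ d _ ())
  first-return returns? (suc b) with first-return returns? b
  ... | inj₂ (d , 1≤d , d<b , ret , first) = inj₂ (d , 1≤d , ℕₚ.m≤n⇒m≤1+n d<b , ret , first)
  ... | inj₁ none with returns? b
  ...   | no ¬ret = inj₁ extend
    where
    extend : NoReturnBelow (suc b)
    extend d 1≤d d<sb with ℕₚ.m≤n⇒m<n∨m≡n (ℕₚ.≤-pred d<sb)
    ... | inj₁ d<b  = none d 1≤d d<b
    ... | inj₂ refl = ¬ret
  ...   | yes ret with 1 ℕ.≤? b
  ...     | yes 1≤b = inj₂ (b , 1≤b , ℕₚ.n<1+n b , ret , none)
  ...     | no  b≱1 = inj₁ (λ d 1≤d d<sb → ⊥-elim (b≱1 (ℕₚ.≤-trans 1≤d (ℕₚ.≤-pred d<sb))))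

  first-return-divides : ∀ d → 1 ℕ.≤ d → Returns d → NoReturnBelow d →
                         ∀ m → Returns m → Σ ℕ λ t → m ≡ t ℕ.* d
  first-return-divides d 1≤d ret first m ret-m = m ℕ./ d , m≡td
    where
    instance
      d≢0 : ℕ.NonZero d
      d≢0 = ℕ.>-nonZero 1≤d
    open Period {d} ret
    r t : ℕ
    r = m ℕ.% d
    t = m ℕ./ d
    m≡td+r : m ≡ t ℕ.* d ℕ.+ r
    m≡td+r = trans (ℕ.m≡m%n+[m/n]*n m d) (ℕₚ.+-comm r (t ℕ.* d))
    ret-r : Returns r
    ret-r = trans (sym (periodic* t r)) (trans (cong iterate (sym m≡td+r)) ret-m)
    r≡0 : r ≡ 0
    r≡0 with r | ret-r | ℕ.m%n<n m d
    ... | zero  | _   | _   = refl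
    ... | suc r′ | ret′ | r<d = ⊥-elim (first (suc r′) (s≤s z≤n) r<d ret′)
    m≡td : m ≡ t ℕ.* d
    m≡td = trans m≡td+r (trans (cong (t ℕ.* d ℕ.+_) r≡0) (ℕₚ.+-identityʳ _))

module PowerArithmetic (q k′ : ℕ) (2≤q : 2 ℕ.≤ q) where
  m : ℕ
  m = q ℕ.^ suc k′ ℕ.∸ 1

  1≤q^ : ∀ n → 1 ℕ.≤ q ℕ.^ n
  1≤q^ zero    = ℕₚ.≤-refl
  1≤q^ (suc n) = ℕₚ.*-mono-≤ (ℕₚ.≤-trans (s≤s z≤n) 2≤q) (1≤q^ n)

  m+1≡q^k : m ℕ.+ 1 ≡ q ℕ.^ suc k′
  m+1≡q^k = ℕₚ.m∸n+n≡m (1≤q^ (suc k′))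

  -- q^k - 1 ≥ 2·q^(k-1) - 1 ≥ q^(k-1)
  q^k′≤m : q ℕ.^ k′ ℕ.≤ m
  q^k′≤m = ℕₚ.≤-trans (ℕₚ.≤-reflexive (sym (ℕₚ.m+n∸n≡m Q 1)))
    (ℕₚ.∸-monoˡ-≤ 1 (ℕₚ.≤-trans (ℕₚ.+-monoʳ-≤ Q (ℕₚ.≤-trans (1≤q^ k′) (ℕₚ.≤-reflexive (sym (ℕₚ.+-identityʳ Q)))))
                                 (ℕₚ.*-monoˡ-≤ Q 2≤q)))
    where Q = q ℕ.^ k′

  1≤m : 1 ℕ.≤ m
  1≤m = ℕₚ.≤-trans (1≤q^ k′) q^k′≤m

  target≡ : (q ℕ.∸ 1) ℕ.* q ℕ.^ k′ ℕ.∸ 1 ≡ m ℕ.∸ q ℕ.^ k′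
  target≡ = begin
    (q ℕ.∸ 1) ℕ.* Q ℕ.∸ 1        ≡⟨ cong (ℕ._∸ 1) (ℕₚ.*-distribʳ-∸ Q q 1) ⟩
    (q ℕ.* Q ℕ.∸ 1 ℕ.* Q) ℕ.∸ 1  ≡⟨ cong (λ z → (q ℕ.* Q ℕ.∸ z) ℕ.∸ 1) (ℕₚ.*-identityˡ Q) ⟩
    (q ℕ.* Q ℕ.∸ Q) ℕ.∸ 1        ≡⟨ ℕₚ.∸-+-assoc (q ℕ.* Q) Q 1 ⟩
    q ℕ.* Q ℕ.∸ (Q ℕ.+ 1)        ≡⟨ cong (q ℕ.* Q ℕ.∸_) (ℕₚ.+-comm Q 1) ⟩
    q ℕ.* Q ℕ.∸ (1 ℕ.+ Q)        ≡⟨ sym (ℕₚ.∸-+-assoc (q ℕ.* Q) 1 Q) ⟩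
    m ℕ.∸ Q                      ∎
    where
    open ≡-Reasoning
    Q = q ℕ.^ k′

  common-divisor≡1 : ∀ t → t ℕ.∣ q ℕ.^ k′ → t ℕ.∣ m → t ≡ 1
  common-divisor≡1 t t∣Q t∣m = ℕ.∣1⇒≡1 (ℕ.∣m+n∣m⇒∣n t∣m+1 t∣m)
    where
    t∣m+1 : t ℕ.∣ m ℕ.+ 1
    t∣m+1 = subst (t ℕ.∣_) (sym m+1≡q^k) (ℕ.∣n⇒∣m*n q t∣Q)

module FieldFacts {q : ℕ} (F : FiniteField q) where
  open FiniteField F public
  open IsCommutativeRing isCommRing public using
    ( +-assoc; +-comm; +-identityˡ; +-identityʳ; -‿inverseʳ; -‿inverseˡ
    ; *-assoc; *-comm; *-identityˡ; *-identityʳ; distribˡ; distribʳ; zeroˡ; zeroʳ)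

  commutativeRing : CommutativeRing 0ℓ 0ℓ
  commutativeRing = record { isCommutativeRing = isCommRing }

  open RingProperties (CommutativeRing.ring commutativeRing) public using
    ( -0#≈0#; -‿involutive; -‿+-comm; -‿distribˡ-*; -‿distribʳ-*; -1*x≈-x
    ; x∙y⁻¹≈ε⇒x≈y; x+x≈x⇒x≈0; +-cancelˡ; +-cancelʳ)

  private
    semiring = CommutativeRing.semiring commutativeRing
    open SemiringMult semiring using () renaming (_×_ to _×1#_)

    -- equality of numerals, as required by the solver (a sound partial test)
    numerals≟ : ∀ m n → Maybe (m ×1# 1# ≡ n ×1# 1#)
    numerals≟ m n with m ℕ.≟ n
    ... | yes refl = just refl
    ... | no  _    = nothing

  open NaturalCoefficients (CommutativeRing.commutativeSemiring commutativeRing) numerals≟ public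
    using (solve; _:=_; _:+_; _:*_; con)

  open ≡-Reasoning

  1≢0 : 1# ≢ 0#
  1≢0 e = 0≢1 (sym e)

  +-zeroʳ : ∀ x {y} → y ≡ 0# → x + y ≡ x
  +-zeroʳ x y≡0 = trans (cong (x +_) y≡0) (+-identityʳ x)

  *-cancelˡ : ∀ a b c → a ≢ 0# → a * b ≡ a * c → b ≡ c
  *-cancelˡ a b c a≢0 ab≡ac = begin
    b              ≡⟨ sym (*-identityˡ b) ⟩
    1# * b         ≡⟨ cong (_* b) (sym a⁻¹a≡1) ⟩
    (a⁻¹ * a) * b  ≡⟨ *-assoc _ _ _ ⟩
    a⁻¹ * (a * b)  ≡⟨ cong (a⁻¹ *_) ab≡ac ⟩
    a⁻¹ * (a * c)  ≡⟨ sym (*-assoc _ _ _) ⟩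
    (a⁻¹ * a) * c  ≡⟨ cong (_* c) a⁻¹a≡1 ⟩
    1# * c         ≡⟨ *-identityˡ c ⟩
    c              ∎
    where
    a⁻¹ = proj₁ (inverse a a≢0)
    a⁻¹a≡1 : a⁻¹ * a ≡ 1#
    a⁻¹a≡1 = trans (*-comm _ _) (proj₂ (inverse a a≢0))

  nonzero-* : ∀ a b → a ≢ 0# → b ≢ 0# → a * b ≢ 0#
  nonzero-* a b a≢0 b≢0 ab≡0 = b≢0 (*-cancelˡ a b 0# a≢0 (trans ab≡0 (sym (zeroʳ a))))


module OverField {q : ℕ} (F : FiniteField q) where
  open FieldFacts F
  open ≡-Reasoning

  coef : Poly F → ℕ → Carrier
  coef = coeff F

  infixl 6 _+ₚ_
  infixl 7 _*ₚ_ _·ₚ_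
  infix  4 _≈_

  _+ₚ_ _*ₚ_ : Poly F → Poly F → Poly F
  _+ₚ_ = addP F
  _*ₚ_ = mulP F

  _·ₚ_ : Carrier → Poly F → Poly F
  a ·ₚ f = map (a *_) f

  _≈_ : Poly F → Poly F → Set
  _≈_ = _≈P_ F

  ≈-sym : ∀ {f g} → f ≈ g → g ≈ f
  ≈-sym e n = sym (e n)

  ≈-trans : ∀ {f g h} → f ≈ g → g ≈ h → f ≈ h
  ≈-trans e e′ n = trans (e n) (e′ n)

  -- the coefficient sequence of x·h
  shift : (ℕ → Carrier) → ℕ → Carrier
  shift h zero    = 0#
  shift h (suc n) = h n

  shift-cong : ∀ {h h′} → (∀ i → h i ≡ h′ i) → ∀ n → shift h n ≡ shift h′ n
  shift-cong e zero    = refl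
  shift-cong e (suc n) = e n

  shift-zero : ∀ h → (∀ i → h i ≡ 0#) → ∀ n → shift h n ≡ 0#
  shift-zero h z zero    = refl
  shift-zero h z (suc n) = z n

  shift-+ : ∀ h h′ n → shift (λ i → h i + h′ i) n ≡ shift h n + shift h′ n
  shift-+ h h′ zero    = sym (+-identityˡ 0#)
  shift-+ h h′ (suc n) = refl

  shift-* : ∀ c h n → shift (λ i → c * h i) n ≡ c * shift h n
  shift-* c h zero    = sym (zeroʳ c)
  shift-* c h (suc n) = refl

  coef-x* : ∀ f n → coef (0# ∷ f) n ≡ shift (coef f) n
  coef-x* f zero    = refl
  coef-x* f (suc n) = refl

  coef-+ : ∀ f g n → coef (f +ₚ g) n ≡ coef f n + coef g n
  coef-+ []      g       n       = sym (+-identityˡ _)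
  coef-+ (a ∷ f) []      n       = sym (+-identityʳ _)
  coef-+ (a ∷ f) (b ∷ g) zero    = refl
  coef-+ (a ∷ f) (b ∷ g) (suc n) = coef-+ f g n

  coef-· : ∀ a f n → coef (a ·ₚ f) n ≡ a * coef f n
  coef-· a []      n       = sym (zeroʳ a)
  coef-· a (b ∷ f) zero    = refl
  coef-· a (b ∷ f) (suc n) = coef-· a f n

  coef-*-∷ˡ : ∀ a f g n → coef ((a ∷ f) *ₚ g) n ≡ a * coef g n + shift (coef (f *ₚ g)) n
  coef-*-∷ˡ a f g n = trans (coef-+ (a ·ₚ g) (0# ∷ f *ₚ g) n) (cong₂ _+_ (coef-· a g n) (coef-x* (f *ₚ g) n))

  coef-*-∷ʳ : ∀ f b g n → coef (f *ₚ (b ∷ g)) n ≡ b * coef f n + shift (coef (f *ₚ g)) n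
  coef-*-∷ʳ [] b g n = begin
    0#                     ≡⟨ sym (+-identityʳ 0#) ⟩
    0# + 0#                ≡⟨ cong₂ _+_ (sym (zeroʳ b)) (sym (shift-zero _ (λ _ → refl) n)) ⟩
    b * 0# + shift (coef []) n ∎
  coef-*-∷ʳ (a ∷ f) b g zero = begin
    coef ((a ∷ f) *ₚ (b ∷ g)) 0 ≡⟨ coef-*-∷ˡ a f (b ∷ g) 0 ⟩
    a * b + 0#                  ≡⟨ cong (_+ 0#) (*-comm a b) ⟩
    b * a + 0#                  ∎
  coef-*-∷ʳ (a ∷ f) b g (suc n) = begin
    coef ((a ∷ f) *ₚ (b ∷ g)) (suc n)                 ≡⟨ coef-*-∷ˡ a f (b ∷ g) (suc n) ⟩
    a * coef g n + coef (f *ₚ (b ∷ g)) n              ≡⟨ cong (a * coef g n +_) (coef-*-∷ʳ f b g n) ⟩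
    a * coef g n + (b * coef f n + shift (coef (f *ₚ g)) n)
      ≡⟨ solve 5 (λ a g b f s → (a :* g :+ (b :* f :+ s)) := (b :* f :+ (a :* g :+ s))) refl a (coef g n) b (coef f n) _ ⟩
    b * coef f n + (a * coef g n + shift (coef (f *ₚ g)) n) ≡⟨ cong (b * coef f n +_) (sym (coef-*-∷ˡ a f g n)) ⟩
    b * coef (a ∷ f) (suc n) + shift (coef ((a ∷ f) *ₚ g)) (suc n) ∎

  coef-*-0 : ∀ f g → coef (f *ₚ g) 0 ≡ coef f 0 * coef g 0
  coef-*-0 []      g = sym (zeroˡ _)
  coef-*-0 (a ∷ f) g = trans (coef-*-∷ˡ a f g 0) (+-identityʳ _)

  *ₚ-congʳ : ∀ f {g g′} → g ≈ g′ → f *ₚ g ≈ f *ₚ g′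
  *ₚ-congʳ []      e n = refl
  *ₚ-congʳ (a ∷ f) {g} {g′} e n = begin
    coef ((a ∷ f) *ₚ g) n                  ≡⟨ coef-*-∷ˡ a f g n ⟩
    a * coef g n + shift (coef (f *ₚ g)) n   ≡⟨ cong₂ _+_ (cong (a *_) (e n)) (shift-cong (*ₚ-congʳ f e) n) ⟩
    a * coef g′ n + shift (coef (f *ₚ g′)) n ≡⟨ sym (coef-*-∷ˡ a f g′ n) ⟩
    coef ((a ∷ f) *ₚ g′) n                 ∎

  *ₚ-distribˡ : ∀ f g h → f *ₚ (g +ₚ h) ≈ f *ₚ g +ₚ f *ₚ h
  *ₚ-distribˡ []      g h n = refl
  *ₚ-distribˡ (a ∷ f) g h n = begin
    coef ((a ∷ f) *ₚ (g +ₚ h)) n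
      ≡⟨ coef-*-∷ˡ a f _ n ⟩
    a * coef (g +ₚ h) n + shift (coef (f *ₚ (g +ₚ h))) n
      ≡⟨ cong₂ _+_ (cong (a *_) (coef-+ g h n))
           (trans (shift-cong (λ i → trans (*ₚ-distribˡ f g h i) (coef-+ (f *ₚ g) (f *ₚ h) i)) n) (shift-+ _ _ n)) ⟩
    a * (coef g n + coef h n) + (shift (coef (f *ₚ g)) n + shift (coef (f *ₚ h)) n)
      ≡⟨ solve 5 (λ a g h x y → (a :* (g :+ h) :+ (x :+ y)) := ((a :* g :+ x) :+ (a :* h :+ y))) refl a (coef g n) (coef h n) _ _ ⟩
    (a * coef g n + shift (coef (f *ₚ g)) n) + (a * coef h n + shift (coef (f *ₚ h)) n)
      ≡⟨ sym (cong₂ _+_ (coef-*-∷ˡ a f g n) (coef-*-∷ˡ a f h n)) ⟩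
    coef ((a ∷ f) *ₚ g) n + coef ((a ∷ f) *ₚ h) n
      ≡⟨ sym (coef-+ ((a ∷ f) *ₚ g) ((a ∷ f) *ₚ h) n) ⟩
    coef ((a ∷ f) *ₚ g +ₚ (a ∷ f) *ₚ h) n ∎

  *ₚ-·-comm : ∀ f c g → f *ₚ (c ·ₚ g) ≈ c ·ₚ (f *ₚ g)
  *ₚ-·-comm []      c g n = refl
  *ₚ-·-comm (a ∷ f) c g n = begin
    coef ((a ∷ f) *ₚ (c ·ₚ g)) n
      ≡⟨ coef-*-∷ˡ a f _ n ⟩
    a * coef (c ·ₚ g) n + shift (coef (f *ₚ (c ·ₚ g))) n
      ≡⟨ cong₂ _+_ (cong (a *_) (coef-· c g n))
           (trans (shift-cong (λ i → trans (*ₚ-·-comm f c g i) (coef-· c (f *ₚ g) i)) n) (shift-* c _ n)) ⟩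
    a * (c * coef g n) + c * shift (coef (f *ₚ g)) n
      ≡⟨ solve 4 (λ a c g s → (a :* (c :* g) :+ c :* s) := (c :* (a :* g :+ s))) refl a c (coef g n) _ ⟩
    c * (a * coef g n + shift (coef (f *ₚ g)) n) ≡⟨ cong (c *_) (sym (coef-*-∷ˡ a f g n)) ⟩
    c * coef ((a ∷ f) *ₚ g) n                   ≡⟨ sym (coef-· c ((a ∷ f) *ₚ g) n) ⟩
    coef (c ·ₚ ((a ∷ f) *ₚ g)) n ∎

  *ₚ-zeroˡ : ∀ f g → (∀ i → coef f i ≡ 0#) → ∀ j → coef (f *ₚ g) j ≡ 0#
  *ₚ-zeroˡ []      g z j = refl
  *ₚ-zeroˡ (a ∷ f) g z j = begin
    coef ((a ∷ f) *ₚ g) j                  ≡⟨ coef-*-∷ˡ a f g j ⟩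
    a * coef g j + shift (coef (f *ₚ g)) j ≡⟨ cong₂ _+_ (cong (_* coef g j) (z 0)) (shift-zero _ (*ₚ-zeroˡ f g (λ i → z (suc i))) j) ⟩
    0# * coef g j + 0#                     ≡⟨ trans (+-identityʳ _) (zeroˡ _) ⟩
    0#                                     ∎

  coef-*-top : ∀ f g a b → (∀ i → a ℕ.< i → coef f i ≡ 0#) → (∀ j → b ℕ.< j → coef g j ≡ 0#) →
               coef (f *ₚ g) (a ℕ.+ b) ≡ coef f a * coef g b
  coef-*-top []      g a b zf zg = sym (zeroˡ _)
  coef-*-top (x ∷ f) g zero b zf zg = begin
    coef ((x ∷ f) *ₚ g) b                   ≡⟨ coef-*-∷ˡ x f g b ⟩
    x * coef g b + shift (coef (f *ₚ g)) b  ≡⟨ +-zeroʳ _ (shift-zero _ (*ₚ-zeroˡ f g (λ i → zf (suc i) (s≤s z≤n))) b) ⟩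
    x * coef g b                            ∎
  coef-*-top (x ∷ f) g (suc a) b zf zg = begin
    coef ((x ∷ f) *ₚ g) (suc (a ℕ.+ b))        ≡⟨ coef-*-∷ˡ x f g _ ⟩
    x * coef g (suc (a ℕ.+ b)) + coef (f *ₚ g) (a ℕ.+ b)
      ≡⟨ cong₂ _+_ (cong (x *_) (zg _ (s≤s (ℕₚ.m≤n+m b a)))) (coef-*-top f g a b (λ i lt → zf (suc i) (s≤s lt)) zg) ⟩
    x * 0# + coef f a * coef g b               ≡⟨ trans (cong (_+ coef f a * coef g b) (zeroʳ x)) (+-identityˡ _) ⟩
    coef f a * coef g b                        ∎

  zero-or-top : ∀ d → (∀ i → coef d i ≡ 0#) ⊎ (Σ ℕ λ b → coef d b ≢ 0# × (∀ j → b ℕ.< j → coef d j ≡ 0#))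
  zero-or-top [] = inj₁ (λ i → refl)
  zero-or-top (a ∷ d) with zero-or-top d
  ... | inj₂ (b , d_b≢0 , above) = inj₂ (suc b , d_b≢0 , λ { (suc j) (s≤s lt) → above j lt })
  ... | inj₁ d≈0 with a ≟ 0#
  ...   | yes a≡0 = inj₁ (λ { zero → a≡0 ; (suc i) → d≈0 i })
  ...   | no  a≢0 = inj₂ (zero , a≢0 , λ { (suc j) _ → d≈0 j })

  monic-cancel : ∀ P k → coef P k ≡ 1# → (∀ i → k ℕ.< i → coef P i ≡ 0#) →
                 ∀ d → (∀ i → coef (P *ₚ d) i ≡ 0#) → ∀ i → coef d i ≡ 0#
  monic-cancel P k P-top P-above d Pd≈0 with zero-or-top d
  ... | inj₁ d≈0 = d≈0
  ... | inj₂ (b , d_b≢0 , d-above) = ⊥-elim (d_b≢0 (begin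
    coef d b                 ≡⟨ sym (*-identityˡ _) ⟩
    1# * coef d b            ≡⟨ cong (_* coef d b) (sym P-top) ⟩
    coef P k * coef d b      ≡⟨ sym (coef-*-top P d k b P-above d-above) ⟩
    coef (P *ₚ d) (k ℕ.+ b)  ≡⟨ Pd≈0 _ ⟩
    0#                       ∎))

  monic-*ₚ-cancelˡ : ∀ P k → coef P k ≡ 1# → (∀ i → k ℕ.< i → coef P i ≡ 0#) →
                     ∀ g h → P *ₚ g ≈ P *ₚ h → g ≈ h
  monic-*ₚ-cancelˡ P k P-top P-above g h Pg≈Ph i = x∙y⁻¹≈ε⇒x≈y (coef g i) (coef h i) (begin
    coef g i + - coef h i              ≡⟨ cong (coef g i +_) (sym (trans (coef-· (- 1#) h i) (-1*x≈-x _))) ⟩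
    coef g i + coef ((- 1#) ·ₚ h) i    ≡⟨ sym (coef-+ g ((- 1#) ·ₚ h) i) ⟩
    coef (g +ₚ (- 1#) ·ₚ h) i          ≡⟨ monic-cancel P k P-top P-above (g +ₚ (- 1#) ·ₚ h) P[g-h]≈0 i ⟩
    0#                                 ∎)
    where
    P[g-h]≈0 : ∀ i → coef (P *ₚ (g +ₚ (- 1#) ·ₚ h)) i ≡ 0#
    P[g-h]≈0 i = begin
      coef (P *ₚ (g +ₚ (- 1#) ·ₚ h)) i           ≡⟨ *ₚ-distribˡ P g ((- 1#) ·ₚ h) i ⟩
      coef (P *ₚ g +ₚ P *ₚ ((- 1#) ·ₚ h)) i      ≡⟨ coef-+ (P *ₚ g) _ i ⟩
      coef (P *ₚ g) i + coef (P *ₚ ((- 1#) ·ₚ h)) i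
        ≡⟨ cong₂ _+_ (Pg≈Ph i) (trans (*ₚ-·-comm P (- 1#) h i) (trans (coef-· (- 1#) (P *ₚ h) i) (-1*x≈-x _))) ⟩
      coef (P *ₚ h) i + - coef (P *ₚ h) i        ≡⟨ -‿inverseʳ _ ⟩
      0#                                         ∎

  -- Every polynomial f then acts on M as f(T); this is used for the
  -- residue ring, for F itself (x acting as 1) and for an extension field of F.
  record FxModule : Set₁ where
    infixl 6 _⊕_
    infixr 7 _⊙_
    field
      M       : Set
      _⊕_     : M → M → M
      0ᴹ      : M
      _⊙_     : Carrier → M → M
      T       : M → M
      ⊕-assoc : ∀ x y z → (x ⊕ y) ⊕ z ≡ x ⊕ (y ⊕ z)
      ⊕-comm  : ∀ x y → x ⊕ y ≡ y ⊕ x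
      ⊕-idˡ   : ∀ x → 0ᴹ ⊕ x ≡ x
      ⊙-distˡ : ∀ a x y → a ⊙ (x ⊕ y) ≡ a ⊙ x ⊕ a ⊙ y
      ⊙-distʳ : ∀ a b x → (a + b) ⊙ x ≡ a ⊙ x ⊕ b ⊙ x
      ⊙-assoc : ∀ a b x → (a * b) ⊙ x ≡ a ⊙ (b ⊙ x)
      ⊙-one   : ∀ x → 1# ⊙ x ≡ x
      ⊙-zero  : ∀ x → 0# ⊙ x ≡ 0ᴹ
      T-⊕     : ∀ x y → T (x ⊕ y) ≡ T x ⊕ T y
      T-⊙     : ∀ a x → T (a ⊙ x) ≡ a ⊙ T x

  module FxModuleTheory (𝕄 : FxModule) where
    open FxModule 𝕄

    ⊕-idʳ : ∀ x → x ⊕ 0ᴹ ≡ x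
    ⊕-idʳ x = trans (⊕-comm x 0ᴹ) (⊕-idˡ x)

    ⊙-zeroʳ : ∀ a → a ⊙ 0ᴹ ≡ 0ᴹ
    ⊙-zeroʳ a = begin
      a ⊙ 0ᴹ          ≡⟨ cong (a ⊙_) (sym (⊙-zero 0ᴹ)) ⟩
      a ⊙ (0# ⊙ 0ᴹ)   ≡⟨ sym (⊙-assoc a 0# 0ᴹ) ⟩
      (a * 0#) ⊙ 0ᴹ   ≡⟨ cong (_⊙ 0ᴹ) (zeroʳ a) ⟩
      0# ⊙ 0ᴹ         ≡⟨ ⊙-zero 0ᴹ ⟩
      0ᴹ              ∎

    T-0 : T 0ᴹ ≡ 0ᴹ
    T-0 = trans (cong T (sym (⊙-zero 0ᴹ))) (trans (T-⊙ 0# 0ᴹ) (⊙-zero _))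

    ⊙-comm : ∀ a b x → a ⊙ (b ⊙ x) ≡ b ⊙ (a ⊙ x)
    ⊙-comm a b x = trans (sym (⊙-assoc a b x)) (trans (cong (_⊙ x) (*-comm a b)) (⊙-assoc b a x))

    ⊕-interchange : ∀ a b c d → (a ⊕ b) ⊕ (c ⊕ d) ≡ (a ⊕ c) ⊕ (b ⊕ d)
    ⊕-interchange a b c d = begin
      (a ⊕ b) ⊕ (c ⊕ d) ≡⟨ ⊕-assoc a b (c ⊕ d) ⟩
      a ⊕ (b ⊕ (c ⊕ d)) ≡⟨ cong (a ⊕_) (sym (⊕-assoc b c d)) ⟩
      a ⊕ ((b ⊕ c) ⊕ d) ≡⟨ cong (λ z → a ⊕ (z ⊕ d)) (⊕-comm b c) ⟩
      a ⊕ ((c ⊕ b) ⊕ d) ≡⟨ cong (a ⊕_) (⊕-assoc c b d) ⟩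
      a ⊕ (c ⊕ (b ⊕ d)) ≡⟨ sym (⊕-assoc a c (b ⊕ d)) ⟩
      (a ⊕ c) ⊕ (b ⊕ d) ∎

    act : Poly F → M → M
    act []      v = 0ᴹ
    act (a ∷ f) v = a ⊙ v ⊕ T (act f v)

    act-cong : ∀ f g → f ≈ g → ∀ v → act f v ≡ act g v
    act-cong []      []      e v = refl
    act-cong []      (b ∷ g) e v = sym (begin
      b ⊙ v ⊕ T (act g v) ≡⟨ cong₂ (λ x y → x ⊙ v ⊕ T y) (sym (e 0)) (sym (act-cong [] g (λ n → e (suc n)) v)) ⟩
      0# ⊙ v ⊕ T 0ᴹ       ≡⟨ cong₂ _⊕_ (⊙-zero v) T-0 ⟩
      0ᴹ ⊕ 0ᴹ             ≡⟨ ⊕-idˡ 0ᴹ ⟩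
      0ᴹ                  ∎)
    act-cong (a ∷ f) []      e v = begin
      a ⊙ v ⊕ T (act f v) ≡⟨ cong₂ (λ x y → x ⊙ v ⊕ T y) (e 0) (act-cong f [] (λ n → e (suc n)) v) ⟩
      0# ⊙ v ⊕ T 0ᴹ       ≡⟨ cong₂ _⊕_ (⊙-zero v) T-0 ⟩
      0ᴹ ⊕ 0ᴹ             ≡⟨ ⊕-idˡ 0ᴹ ⟩
      0ᴹ                  ∎
    act-cong (a ∷ f) (b ∷ g) e v = cong₂ (λ x y → x ⊙ v ⊕ T y) (e 0) (act-cong f g (λ n → e (suc n)) v)

    act-+ₚ : ∀ f g v → act (f +ₚ g) v ≡ act f v ⊕ act g v
    act-+ₚ []      g       v = sym (⊕-idˡ _)
    act-+ₚ (a ∷ f) []      v = sym (⊕-idʳ _)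
    act-+ₚ (a ∷ f) (b ∷ g) v = begin
      (a + b) ⊙ v ⊕ T (act (f +ₚ g) v)              ≡⟨ cong₂ _⊕_ (⊙-distʳ a b v) (trans (cong T (act-+ₚ f g v)) (T-⊕ _ _)) ⟩
      (a ⊙ v ⊕ b ⊙ v) ⊕ (T (act f v) ⊕ T (act g v)) ≡⟨ ⊕-interchange _ _ _ _ ⟩
      (a ⊙ v ⊕ T (act f v)) ⊕ (b ⊙ v ⊕ T (act g v)) ∎

    act-·ₚ : ∀ a f v → act (a ·ₚ f) v ≡ a ⊙ act f v
    act-·ₚ a []      v = sym (⊙-zeroʳ a)
    act-·ₚ a (b ∷ f) v = begin
      (a * b) ⊙ v ⊕ T (act (a ·ₚ f) v) ≡⟨ cong₂ _⊕_ (⊙-assoc a b v) (trans (cong T (act-·ₚ a f v)) (T-⊙ a _)) ⟩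
      a ⊙ (b ⊙ v) ⊕ a ⊙ T (act f v)    ≡⟨ sym (⊙-distˡ a _ _) ⟩
      a ⊙ (b ⊙ v ⊕ T (act f v))        ∎

    act-x* : ∀ f v → act (0# ∷ f) v ≡ T (act f v)
    act-x* f v = trans (cong (_⊕ T (act f v)) (⊙-zero v)) (⊕-idˡ _)

    act-1 : ∀ v → act [ 1# ] v ≡ v
    act-1 v = trans (cong₂ _⊕_ (⊙-one v) T-0) (⊕-idʳ v)

    act-⊕ : ∀ f v w → act f (v ⊕ w) ≡ act f v ⊕ act f w
    act-⊕ []      v w = sym (⊕-idˡ 0ᴹ)
    act-⊕ (a ∷ f) v w = begin
      a ⊙ (v ⊕ w) ⊕ T (act f (v ⊕ w))               ≡⟨ cong₂ _⊕_ (⊙-distˡ a v w) (trans (cong T (act-⊕ f v w)) (T-⊕ _ _)) ⟩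
      (a ⊙ v ⊕ a ⊙ w) ⊕ (T (act f v) ⊕ T (act f w)) ≡⟨ ⊕-interchange _ _ _ _ ⟩
      (a ⊙ v ⊕ T (act f v)) ⊕ (a ⊙ w ⊕ T (act f w)) ∎

    act-⊙ : ∀ f a v → act f (a ⊙ v) ≡ a ⊙ act f v
    act-⊙ []      a v = sym (⊙-zeroʳ a)
    act-⊙ (b ∷ f) a v = begin
      b ⊙ (a ⊙ v) ⊕ T (act f (a ⊙ v)) ≡⟨ cong₂ _⊕_ (⊙-comm b a v) (trans (cong T (act-⊙ f a v)) (T-⊙ a _)) ⟩
      a ⊙ (b ⊙ v) ⊕ a ⊙ T (act f v)   ≡⟨ sym (⊙-distˡ a _ _) ⟩
      a ⊙ (b ⊙ v ⊕ T (act f v))       ∎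

    act-0 : ∀ f → act f 0ᴹ ≡ 0ᴹ
    act-0 f = trans (cong (act f) (sym (⊙-zero 0ᴹ))) (trans (act-⊙ f 0# 0ᴹ) (⊙-zero _))

    act-T : ∀ f v → act f (T v) ≡ T (act f v)
    act-T []      v = sym T-0
    act-T (a ∷ f) v = begin
      a ⊙ T v ⊕ T (act f (T v))   ≡⟨ cong₂ _⊕_ (sym (T-⊙ a v)) (cong T (act-T f v)) ⟩
      T (a ⊙ v) ⊕ T (T (act f v)) ≡⟨ sym (T-⊕ _ _) ⟩
      T (a ⊙ v ⊕ T (act f v))     ∎

    act-comm : ∀ f g v → act f (act g v) ≡ act g (act f v)
    act-comm []      g v = sym (act-0 g)
    act-comm (a ∷ f) g v = begin
      a ⊙ act g v ⊕ T (act f (act g v))        ≡⟨ cong₂ _⊕_ (sym (act-⊙ g a v)) (cong T (act-comm f g v)) ⟩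
      act g (a ⊙ v) ⊕ T (act g (act f v))      ≡⟨ cong (act g (a ⊙ v) ⊕_) (sym (act-T g _)) ⟩
      act g (a ⊙ v) ⊕ act g (T (act f v))      ≡⟨ sym (act-⊕ g _ _) ⟩
      act g (a ⊙ v ⊕ T (act f v))              ∎

    act-*ₚ : ∀ f g v → act (f *ₚ g) v ≡ act f (act g v)
    act-*ₚ []      g v = refl
    act-*ₚ (a ∷ f) g v = begin
      act (a ·ₚ g +ₚ (0# ∷ f *ₚ g)) v              ≡⟨ act-+ₚ (a ·ₚ g) _ v ⟩
      act (a ·ₚ g) v ⊕ act (0# ∷ f *ₚ g) v         ≡⟨ cong₂ _⊕_ (act-·ₚ a g v) (act-x* (f *ₚ g) v) ⟩
      a ⊙ act g v ⊕ T (act (f *ₚ g) v)             ≡⟨ cong (λ z → a ⊙ act g v ⊕ T z) (act-*ₚ f g v) ⟩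
      a ⊙ act g v ⊕ T (act f (act g v))            ∎

  -- Coordinate vectors F^n, read as polynomials of degree < n through toList.
  -- Entries are indexed by ℕ, with entry 0# past the end, matching coef.
  Coords : ℕ → Set
  Coords n = Vec Carrier n

  entry : ∀ {n} → Coords n → ℕ → Carrier
  entry []      i       = 0#
  entry (a ∷ v) zero    = a
  entry (a ∷ v) (suc i) = entry v i

  coef-toList : ∀ {n} (v : Coords n) i → coef (toList v) i ≡ entry v i
  coef-toList []      i       = refl
  coef-toList (a ∷ v) zero    = refl
  coef-toList (a ∷ v) (suc i) = coef-toList v i

  entry-beyond : ∀ {n} (v : Coords n) i → n ℕ.≤ i → entry v i ≡ 0#
  entry-beyond []      i       _         = refl
  entry-beyond (a ∷ v) (suc i) (s≤s le) = entry-beyond v i le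

  coef-beyond : ∀ f i → length f ℕ.≤ i → coef f i ≡ 0#
  coef-beyond []      i       _         = refl
  coef-beyond (a ∷ f) (suc i) (s≤s le) = coef-beyond f i le

  entry-ext : ∀ {n} (v w : Coords n) → (∀ i → i ℕ.< n → entry v i ≡ entry w i) → v ≡ w
  entry-ext []      []      e = refl
  entry-ext (a ∷ v) (b ∷ w) e = cong₂ _∷_ (e 0 (s≤s z≤n)) (entry-ext v w (λ i lt → e (suc i) (s≤s lt)))

  fromSeq : (n : ℕ) → (ℕ → Carrier) → Coords n
  fromSeq zero    h = []
  fromSeq (suc n) h = h 0 ∷ fromSeq n (λ i → h (suc i))

  entry-fromSeq< : ∀ n h i → i ℕ.< n → entry (fromSeq n h) i ≡ h i
  entry-fromSeq< (suc n) h zero    _         = refl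
  entry-fromSeq< (suc n) h (suc i) (s≤s lt) = entry-fromSeq< n (λ j → h (suc j)) i lt

  entry-fromSeq : ∀ n h → (∀ i → n ℕ.≤ i → h i ≡ 0#) → ∀ i → entry (fromSeq n h) i ≡ h i
  entry-fromSeq n h vanish i with i ℕ.<? n
  ... | yes lt = entry-fromSeq< n h i lt
  ... | no ¬lt = trans (entry-beyond (fromSeq n h) i (ℕₚ.≮⇒≥ ¬lt)) (sym (vanish i (ℕₚ.≮⇒≥ ¬lt)))

  module CoordOps (n : ℕ) where
    infixl 6 _+ᵛ_
    infixr 7 _·ᵛ_

    _+ᵛ_ : Coords n → Coords n → Coords n
    v +ᵛ w = fromSeq n (λ i → entry v i + entry w i)

    _·ᵛ_ : Carrier → Coords n → Coords n
    a ·ᵛ v = fromSeq n (λ i → a * entry v i)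

    0ᵛ : Coords n
    0ᵛ = fromSeq n (λ _ → 0#)

    -ᵛ_ : Coords n → Coords n
    -ᵛ v = fromSeq n (λ i → - entry v i)

    entry-+ᵛ : ∀ v w i → entry (v +ᵛ w) i ≡ entry v i + entry w i
    entry-+ᵛ v w = entry-fromSeq n _ (λ i le → trans (cong₂ _+_ (entry-beyond v i le) (entry-beyond w i le)) (+-identityˡ 0#))

    entry-·ᵛ : ∀ a v i → entry (a ·ᵛ v) i ≡ a * entry v i
    entry-·ᵛ a v = entry-fromSeq n _ (λ i le → trans (cong (a *_) (entry-beyond v i le)) (zeroʳ a))

    entry-0ᵛ : ∀ i → entry 0ᵛ i ≡ 0#
    entry-0ᵛ = entry-fromSeq n _ (λ i le → refl)

    entry--ᵛ : ∀ v i → entry (-ᵛ v) i ≡ - entry v i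
    entry--ᵛ v = entry-fromSeq n _ (λ i le → trans (cong -_ (entry-beyond v i le)) -0#≈0#)

    entrywise : ∀ {v w : Coords n} → (∀ i → entry v i ≡ entry w i) → v ≡ w
    entrywise {v} {w} e = entry-ext v w (λ i _ → e i)

    +ᵛ-cancelˡ : ∀ x y → x ≡ x +ᵛ y → y ≡ 0ᵛ
    +ᵛ-cancelˡ x y e = entrywise λ i → begin
      entry y i                            ≡⟨ sym (+-identityˡ _) ⟩
      0# + entry y i                       ≡⟨ cong (_+ entry y i) (sym (-‿inverseˡ (entry x i))) ⟩
      (- entry x i + entry x i) + entry y i ≡⟨ +-assoc _ _ _ ⟩
      - entry x i + (entry x i + entry y i) ≡⟨ cong (- entry x i +_) (sym (trans (cong (λ z → entry z i) e) (entry-+ᵛ x y i))) ⟩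
      - entry x i + entry x i              ≡⟨ -‿inverseˡ _ ⟩
      0#                                   ≡⟨ sym (entry-0ᵛ i) ⟩
      entry 0ᵛ i                           ∎

    +ᵛ-cancelʳ : ∀ x y z → x +ᵛ z ≡ y +ᵛ z → x ≡ y
    +ᵛ-cancelʳ x y z e = entrywise λ i → +-cancelʳ (entry z i) (entry x i) (entry y i)
      (trans (sym (entry-+ᵛ x z i)) (trans (cong (λ v → entry v i) e) (entry-+ᵛ y z i)))

    difference-zero : ∀ x y → x +ᵛ -ᵛ y ≡ 0ᵛ → x ≡ y
    difference-zero x y e = entrywise λ i → x∙y⁻¹≈ε⇒x≈y _ _ (begin
      entry x i + - entry y i      ≡⟨ cong (entry x i +_) (sym (entry--ᵛ y i)) ⟩
      entry x i + entry (-ᵛ y) i   ≡⟨ sym (entry-+ᵛ x (-ᵛ y) i) ⟩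
      entry (x +ᵛ -ᵛ y) i          ≡⟨ cong (λ v → entry v i) e ⟩
      entry 0ᵛ i                   ≡⟨ entry-0ᵛ i ⟩
      0#                           ∎)

    toList-+ᵛ : ∀ v w → toList (v +ᵛ w) ≈ toList v +ₚ toList w
    toList-+ᵛ v w i = trans (coef-toList (v +ᵛ w) i) (trans (entry-+ᵛ v w i)
      (trans (cong₂ _+_ (sym (coef-toList v i)) (sym (coef-toList w i))) (sym (coef-+ (toList v) (toList w) i))))

    toList-·ᵛ : ∀ a v → toList (a ·ᵛ v) ≈ a ·ₚ toList v
    toList-·ᵛ a v i = trans (coef-toList (a ·ᵛ v) i) (trans (entry-·ᵛ a v i)
      (trans (cong (a *_) (sym (coef-toList v i))) (sym (coef-· a (toList v) i))))

    toList-0ᵛ : toList 0ᵛ ≈ []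
    toList-0ᵛ i = trans (coef-toList 0ᵛ i) (entry-0ᵛ i)

    toList--ᵛ : ∀ v → toList (-ᵛ v) ≈ (- 1#) ·ₚ toList v
    toList--ᵛ v i = trans (coef-toList (-ᵛ v) i) (trans (entry--ᵛ v i)
      (trans (sym (-1*x≈-x _)) (trans (cong ((- 1#) *_) (sym (coef-toList v i))) (sym (coef-· (- 1#) (toList v) i)))))

  monic : ∀ {m} → Coords m → Poly F
  monic v = toList v ++ [ 1# ]

  coef-monic< : ∀ {m} (v : Coords m) i → i ℕ.< m → coef (monic v) i ≡ entry v i
  coef-monic< (a ∷ v) zero    _         = refl
  coef-monic< (a ∷ v) (suc i) (s≤s lt) = coef-monic< v i lt

  coef-monic-top : ∀ {m} (v : Coords m) → coef (monic v) m ≡ 1#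
  coef-monic-top []      = refl
  coef-monic-top (a ∷ v) = coef-monic-top v

  coef-monic> : ∀ {m} (v : Coords m) i → m ℕ.< i → coef (monic v) i ≡ 0#
  coef-monic> []      (suc i) _         = refl
  coef-monic> (a ∷ v) (suc i) (s≤s lt) = coef-monic> v i lt

  -- The residue ring F[x]/(P) of a monic P = monic c of degree n = suc n′,
  -- realised on F^n: a vector v stands for the class of the polynomial v, and
  -- T = mulX is multiplication by x followed by reduction modulo P.
  module Residues (n′ : ℕ) (c : Coords (suc n′)) where
    n : ℕ
    n = suc n′
    open CoordOps n public

    P : Poly F
    P = monic c

    top : Coords n → Carrier
    top v = entry v n′

    -- x·v has degree n; subtracting top(v)·P reduces it below n
    mulX-seq : Coords n → ℕ → Carrier
    mulX-seq v i = shift (entry v) i + (- top v) * coef P i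

    mulX-seq-vanish : ∀ v i → n ℕ.≤ i → mulX-seq v i ≡ 0#
    mulX-seq-vanish v (suc j) (s≤s le) with n′ ℕ.≟ j
    ... | yes refl = begin
      entry v n′ + (- entry v n′) * coef P n ≡⟨ cong (λ z → entry v n′ + (- entry v n′) * z) (coef-monic-top c) ⟩
      entry v n′ + (- entry v n′) * 1#       ≡⟨ cong (entry v n′ +_) (*-identityʳ _) ⟩
      entry v n′ + - entry v n′              ≡⟨ -‿inverseʳ _ ⟩
      0#                                     ∎
    ... | no n′≢j = begin
      entry v j + (- top v) * coef P (suc j) ≡⟨ cong₂ (λ a b → a + (- top v) * b) (entry-beyond v j n≤j) (coef-monic> c (suc j) (s≤s n≤j)) ⟩
      0# + (- top v) * 0#                    ≡⟨ trans (+-identityˡ _) (zeroʳ _) ⟩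
      0#                                     ∎
      where
      n≤j : n ℕ.≤ j
      n≤j = ℕₚ.≤∧≢⇒< le n′≢j

    mulX : Coords n → Coords n
    mulX v = fromSeq n (mulX-seq v)

    entry-mulX : ∀ v i → entry (mulX v) i ≡ mulX-seq v i
    entry-mulX v = entry-fromSeq n (mulX-seq v) (mulX-seq-vanish v)

    mulX-poly : ∀ v → toList (mulX v) ≈ (0# ∷ toList v) +ₚ (- top v) ·ₚ P
    mulX-poly v i = begin
      coef (toList (mulX v)) i                 ≡⟨ coef-toList (mulX v) i ⟩
      entry (mulX v) i                         ≡⟨ entry-mulX v i ⟩
      shift (entry v) i + (- top v) * coef P i ≡⟨ cong₂ _+_ (trans (shift-cong (λ j → sym (coef-toList v j)) i) (sym (coef-x* (toList v) i)))
                                                            (sym (coef-· (- top v) P i)) ⟩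
      coef (0# ∷ toList v) i + coef ((- top v) ·ₚ P) i ≡⟨ sym (coef-+ (0# ∷ toList v) ((- top v) ·ₚ P) i) ⟩
      coef ((0# ∷ toList v) +ₚ (- top v) ·ₚ P) i ∎

    mulX-+ᵛ : ∀ v w → mulX (v +ᵛ w) ≡ mulX v +ᵛ mulX w
    mulX-+ᵛ v w = entrywise λ i → begin
      entry (mulX (v +ᵛ w)) i ≡⟨ entry-mulX (v +ᵛ w) i ⟩
      shift (entry (v +ᵛ w)) i + (- entry (v +ᵛ w) n′) * coef P i
        ≡⟨ cong₂ (λ a b → a + (- b) * coef P i) (trans (shift-cong (entry-+ᵛ v w) i) (shift-+ (entry v) (entry w) i)) (entry-+ᵛ v w n′) ⟩
      (shift (entry v) i + shift (entry w) i) + (- (top v + top w)) * coef P i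
        ≡⟨ cong (λ z → (shift (entry v) i + shift (entry w) i) + z * coef P i) (sym (-‿+-comm _ _)) ⟩
      (shift (entry v) i + shift (entry w) i) + (- top v + - top w) * coef P i
        ≡⟨ solve 5 (λ x y a b p → ((x :+ y) :+ (a :+ b) :* p) := ((x :+ a :* p) :+ (y :+ b :* p))) refl _ _ _ _ _ ⟩
      mulX-seq v i + mulX-seq w i          ≡⟨ sym (cong₂ _+_ (entry-mulX v i) (entry-mulX w i)) ⟩
      entry (mulX v) i + entry (mulX w) i  ≡⟨ sym (entry-+ᵛ (mulX v) (mulX w) i) ⟩
      entry (mulX v +ᵛ mulX w) i ∎

    mulX-·ᵛ : ∀ a v → mulX (a ·ᵛ v) ≡ a ·ᵛ mulX v
    mulX-·ᵛ a v = entrywise λ i → begin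
      entry (mulX (a ·ᵛ v)) i ≡⟨ entry-mulX (a ·ᵛ v) i ⟩
      shift (entry (a ·ᵛ v)) i + (- entry (a ·ᵛ v) n′) * coef P i
        ≡⟨ cong₂ (λ x y → x + (- y) * coef P i) (trans (shift-cong (entry-·ᵛ a v) i) (shift-* a (entry v) i)) (entry-·ᵛ a v n′) ⟩
      a * shift (entry v) i + (- (a * top v)) * coef P i
        ≡⟨ cong (λ z → a * shift (entry v) i + z * coef P i) (-‿distribʳ-* _ _) ⟩
      a * shift (entry v) i + (a * - top v) * coef P i
        ≡⟨ solve 4 (λ a x t p → (a :* x :+ (a :* t) :* p) := (a :* (x :+ t :* p))) refl _ _ _ _ ⟩
      a * mulX-seq v i          ≡⟨ cong (a *_) (sym (entry-mulX v i)) ⟩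
      a * entry (mulX v) i      ≡⟨ sym (entry-·ᵛ a (mulX v) i) ⟩
      entry (a ·ᵛ mulX v) i     ∎

    residueModule : FxModule
    residueModule = record
      { M = Coords n ; _⊕_ = _+ᵛ_ ; 0ᴹ = 0ᵛ ; _⊙_ = _·ᵛ_ ; T = mulX
      ; ⊕-assoc = λ x y z → entrywise λ i → trans (entry-+ᵛ (x +ᵛ y) z i) (trans (cong (_+ entry z i) (entry-+ᵛ x y i))
          (trans (+-assoc _ _ _) (sym (trans (entry-+ᵛ x (y +ᵛ z) i) (cong (entry x i +_) (entry-+ᵛ y z i))))))
      ; ⊕-comm = λ x y → entrywise λ i → trans (entry-+ᵛ x y i) (trans (+-comm _ _) (sym (entry-+ᵛ y x i)))
      ; ⊕-idˡ = λ x → entrywise λ i → trans (entry-+ᵛ 0ᵛ x i) (trans (cong (_+ entry x i) (entry-0ᵛ i)) (+-identityˡ _))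
      ; ⊙-distˡ = λ a x y → entrywise λ i → trans (entry-·ᵛ a (x +ᵛ y) i) (trans (cong (a *_) (entry-+ᵛ x y i))
          (trans (distribˡ _ _ _) (sym (trans (entry-+ᵛ (a ·ᵛ x) (a ·ᵛ y) i) (cong₂ _+_ (entry-·ᵛ a x i) (entry-·ᵛ a y i))))))
      ; ⊙-distʳ = λ a b x → entrywise λ i → trans (entry-·ᵛ (a + b) x i) (trans (distribʳ _ _ _)
          (sym (trans (entry-+ᵛ (a ·ᵛ x) (b ·ᵛ x) i) (cong₂ _+_ (entry-·ᵛ a x i) (entry-·ᵛ b x i)))))
      ; ⊙-assoc = λ a b x → entrywise λ i → trans (entry-·ᵛ (a * b) x i) (trans (*-assoc _ _ _)
          (sym (trans (entry-·ᵛ a (b ·ᵛ x) i) (cong (a *_) (entry-·ᵛ b x i)))))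
      ; ⊙-one = λ x → entrywise λ i → trans (entry-·ᵛ 1# x i) (*-identityˡ _)
      ; ⊙-zero = λ x → entrywise λ i → trans (entry-·ᵛ 0# x i) (trans (zeroˡ _) (sym (entry-0ᵛ i)))
      ; T-⊕ = mulX-+ᵛ
      ; T-⊙ = mulX-·ᵛ
      }

    open FxModule residueModule using (⊙-one)
    open FxModuleTheory residueModule public

    1ᵛ : Coords n
    1ᵛ = fromSeq n (coef [ 1# ])

    entry-1ᵛ : ∀ i → entry 1ᵛ i ≡ coef [ 1# ] i
    entry-1ᵛ = entry-fromSeq n _ λ { (suc i) _ → refl }

    toList-1ᵛ : toList 1ᵛ ≈ [ 1# ]
    toList-1ᵛ i = trans (coef-toList 1ᵛ i) (entry-1ᵛ i)

    act-1ᵛ : ∀ f → length f ℕ.≤ n → act f 1ᵛ ≡ fromSeq n (coef f)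
    act-1ᵛ []      le       = refl
    act-1ᵛ (a ∷ f) (s≤s le) = entrywise λ i → begin
      entry (a ·ᵛ 1ᵛ +ᵛ mulX (act f 1ᵛ)) i
        ≡⟨ entry-+ᵛ (a ·ᵛ 1ᵛ) (mulX (act f 1ᵛ)) i ⟩
      entry (a ·ᵛ 1ᵛ) i + entry (mulX (act f 1ᵛ)) i
        ≡⟨ cong₂ _+_ (trans (entry-·ᵛ a 1ᵛ i) (cong (a *_) (entry-1ᵛ i)))
                     (trans (cong (λ z → entry (mulX z) i) (act-1ᵛ f (ℕₚ.m≤n⇒m≤1+n le))) (entry-mulX w i)) ⟩
      a * coef [ 1# ] i + (shift (entry w) i + (- entry w n′) * coef P i)
        ≡⟨ cong (λ z → a * coef [ 1# ] i + (shift (entry w) i + z)) (top-term-vanishes i) ⟩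
      a * coef [ 1# ] i + (shift (entry w) i + 0#)
        ≡⟨ horner i ⟩
      coef (a ∷ f) i
        ≡⟨ sym (entry-fromSeq n (coef (a ∷ f)) vanish′ i) ⟩
      entry (fromSeq n (coef (a ∷ f))) i ∎
      where
      w : Coords n
      w = fromSeq n (coef f)
      vanish : ∀ i → n ℕ.≤ i → coef f i ≡ 0#
      vanish i le′ = coef-beyond f i (ℕₚ.≤-trans (ℕₚ.m≤n⇒m≤1+n le) le′)
      vanish′ : ∀ i → n ℕ.≤ i → coef (a ∷ f) i ≡ 0#
      vanish′ (suc i) (s≤s le′) = coef-beyond f i (ℕₚ.≤-trans le le′)
      -- f has degree < n - 1, so no reduction happens
      top-term-vanishes : ∀ i → (- entry w n′) * coef P i ≡ 0#
      top-term-vanishes i = trans (cong (λ z → (- z) * coef P i) (trans (entry-fromSeq n (coef f) vanish n′) (coef-beyond f n′ le)))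
                                (trans (cong (_* coef P i) -0#≈0#) (zeroˡ _))
      horner : ∀ i → a * coef [ 1# ] i + (shift (entry w) i + 0#) ≡ coef (a ∷ f) i
      horner zero    = trans (cong₂ _+_ (*-identityʳ a) (+-identityˡ 0#)) (+-identityʳ a)
      horner (suc i) = begin
        a * 0# + (entry w i + 0#) ≡⟨ cong₂ _+_ (zeroʳ a) (+-identityʳ _) ⟩
        0# + entry w i            ≡⟨ +-identityˡ _ ⟩
        entry w i                 ≡⟨ entry-fromSeq n (coef f) vanish i ⟩
        coef f i                  ∎

    act-toList-1ᵛ : ∀ v → act (toList v) 1ᵛ ≡ v
    act-toList-1ᵛ v = trans (act-1ᵛ (toList v) (ℕₚ.≤-reflexive (length-toList v)))
      (entrywise λ i → trans (entry-fromSeq n _ (λ i le → trans (coef-toList v i) (entry-beyond v i le)) i) (coef-toList v i))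

    -- P kills 1: with v = -x^(n-1) one has top(v) = -1, and mulX v = x·v + P
    P-kills-1ᵛ : act P 1ᵛ ≡ 0ᵛ
    P-kills-1ᵛ = begin
      act P 1ᵛ                ≡⟨ sym (⊙-one _) ⟩
      1# ·ᵛ act P 1ᵛ           ≡⟨ cong (_·ᵛ act P 1ᵛ) (trans (sym (-‿involutive 1#)) (cong -_ (sym (entry-last n′ (- 1#))))) ⟩
      (- top v) ·ᵛ act P 1ᵛ    ≡⟨ +ᵛ-cancelˡ (mulX v) _ (begin
          mulX v                                          ≡⟨ sym (act-toList-1ᵛ (mulX v)) ⟩
          act (toList (mulX v)) 1ᵛ                        ≡⟨ act-cong (toList (mulX v)) ((0# ∷ toList v) +ₚ (- top v) ·ₚ P) (mulX-poly v) 1ᵛ ⟩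
          act ((0# ∷ toList v) +ₚ (- top v) ·ₚ P) 1ᵛ       ≡⟨ act-+ₚ (0# ∷ toList v) ((- top v) ·ₚ P) 1ᵛ ⟩
          act (0# ∷ toList v) 1ᵛ +ᵛ act ((- top v) ·ₚ P) 1ᵛ ≡⟨ cong₂ _+ᵛ_ (trans (act-x* (toList v) 1ᵛ) (cong mulX (act-toList-1ᵛ v)))
                                                                         (act-·ₚ (- top v) P 1ᵛ) ⟩
          mulX v +ᵛ (- top v) ·ᵛ act P 1ᵛ                  ∎) ⟩
      0ᵛ                       ∎
      where
      last : ∀ m → Carrier → Coords (suc m)
      last zero    a = a ∷ []
      last (suc m) a = 0# ∷ last m a
      entry-last : ∀ m a → entry (last m a) m ≡ a
      entry-last zero    a = refl
      entry-last (suc m) a = entry-last m a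
      v : Coords n
      v = last n′ (- 1#)

    P-kills : ∀ w → act P w ≡ 0ᵛ
    P-kills w = begin
      act P w                         ≡⟨ cong (act P) (sym (act-toList-1ᵛ w)) ⟩
      act P (act (toList w) 1ᵛ)       ≡⟨ act-comm P (toList w) 1ᵛ ⟩
      act (toList w) (act P 1ᵛ)       ≡⟨ cong (act (toList w)) P-kills-1ᵛ ⟩
      act (toList w) 0ᵛ               ≡⟨ act-0 (toList w) ⟩
      0ᵛ                              ∎

    module Evaluation (𝕄 : FxModule) (z : FxModule.M 𝕄) (Pz≡0 : FxModuleTheory.act 𝕄 P z ≡ FxModule.0ᴹ 𝕄) where
      private
        module 𝕄 = FxModule 𝕄
        module 𝕄ᵗ = FxModuleTheory 𝕄

      ev : Coords n → 𝕄.M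
      ev v = 𝕄ᵗ.act (toList v) z

      ev-+ᵛ : ∀ v w → ev (v +ᵛ w) ≡ ev v 𝕄.⊕ ev w
      ev-+ᵛ v w = trans (𝕄ᵗ.act-cong (toList (v +ᵛ w)) (toList v +ₚ toList w) (toList-+ᵛ v w) z) (𝕄ᵗ.act-+ₚ (toList v) (toList w) z)

      ev-·ᵛ : ∀ a v → ev (a ·ᵛ v) ≡ a 𝕄.⊙ ev v
      ev-·ᵛ a v = trans (𝕄ᵗ.act-cong (toList (a ·ᵛ v)) (a ·ₚ toList v) (toList-·ᵛ a v) z) (𝕄ᵗ.act-·ₚ a (toList v) z)

      ev-0ᵛ : ev 0ᵛ ≡ 𝕄.0ᴹ
      ev-0ᵛ = 𝕄ᵗ.act-cong (toList 0ᵛ) [] toList-0ᵛ z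

      ev-1ᵛ : ev 1ᵛ ≡ z
      ev-1ᵛ = trans (𝕄ᵗ.act-cong (toList 1ᵛ) [ 1# ] toList-1ᵛ z) (𝕄ᵗ.act-1 z)

      -- reduction modulo P is invisible since P kills z
      ev-mulX : ∀ v → ev (mulX v) ≡ 𝕄.T (ev v)
      ev-mulX v = begin
        𝕄ᵗ.act (toList (mulX v)) z                           ≡⟨ 𝕄ᵗ.act-cong (toList (mulX v)) ((0# ∷ toList v) +ₚ (- top v) ·ₚ P) (mulX-poly v) z ⟩
        𝕄ᵗ.act ((0# ∷ toList v) +ₚ (- top v) ·ₚ P) z         ≡⟨ 𝕄ᵗ.act-+ₚ (0# ∷ toList v) ((- top v) ·ₚ P) z ⟩
        𝕄ᵗ.act (0# ∷ toList v) z 𝕄.⊕ 𝕄ᵗ.act ((- top v) ·ₚ P) z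
          ≡⟨ cong₂ 𝕄._⊕_ (𝕄ᵗ.act-x* (toList v) z) (trans (𝕄ᵗ.act-·ₚ (- top v) P z) (trans (cong ((- top v) 𝕄.⊙_) Pz≡0) (𝕄ᵗ.⊙-zeroʳ _))) ⟩
        𝕄.T (ev v) 𝕄.⊕ 𝕄.0ᴹ                                  ≡⟨ 𝕄ᵗ.⊕-idʳ _ ⟩
        𝕄.T (ev v)                                           ∎

      ev-difference : ∀ v w → ev v ≡ ev w → ev (v +ᵛ -ᵛ w) ≡ 𝕄.0ᴹ
      ev-difference v w e = begin
        ev (v +ᵛ -ᵛ w)                     ≡⟨ ev-+ᵛ v (-ᵛ w) ⟩
        ev v 𝕄.⊕ ev (-ᵛ w)                 ≡⟨ cong₂ 𝕄._⊕_ (trans e (sym (𝕄.⊙-one _))) ev--ᵛ ⟩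
        1# 𝕄.⊙ ev w 𝕄.⊕ (- 1#) 𝕄.⊙ ev w    ≡⟨ sym (𝕄.⊙-distʳ _ _ _) ⟩
        (1# + - 1#) 𝕄.⊙ ev w               ≡⟨ cong (𝕄._⊙ ev w) (-‿inverseʳ 1#) ⟩
        0# 𝕄.⊙ ev w                        ≡⟨ 𝕄.⊙-zero _ ⟩
        𝕄.0ᴹ                               ∎
        where
        ev--ᵛ : ev (-ᵛ w) ≡ (- 1#) 𝕄.⊙ ev w
        ev--ᵛ = trans (𝕄ᵗ.act-cong (toList (-ᵛ w)) ((- 1#) ·ₚ toList w) (toList--ᵛ w) z) (𝕄ᵗ.act-·ₚ (- 1#) (toList w) z)

    -- Multiplication of residue classes: u ⊗ w = u(x)·w.  Its laws all come
    -- from evaluation at w in the residue module itself.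
    infixl 7 _⊗_
    _⊗_ : Coords n → Coords n → Coords n
    u ⊗ w = act (toList u) w

    module EvalAt (w : Coords n) = Evaluation residueModule w (P-kills w)

    act-⊗ : ∀ f v w → act (toList (act f v)) w ≡ act f (act (toList v) w)
    act-⊗ []      v w = EvalAt.ev-0ᵛ w
    act-⊗ (a ∷ f) v w = begin
      EvalAt.ev w (a ·ᵛ v +ᵛ mulX (act f v))                      ≡⟨ EvalAt.ev-+ᵛ w (a ·ᵛ v) (mulX (act f v)) ⟩
      EvalAt.ev w (a ·ᵛ v) +ᵛ EvalAt.ev w (mulX (act f v))        ≡⟨ cong₂ _+ᵛ_ (EvalAt.ev-·ᵛ w a v)
                                                                      (trans (EvalAt.ev-mulX w (act f v)) (cong mulX (act-⊗ f v w))) ⟩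
      a ·ᵛ EvalAt.ev w v +ᵛ mulX (act f (EvalAt.ev w v))          ∎

    ⊗-comm : ∀ u w → u ⊗ w ≡ w ⊗ u
    ⊗-comm u w = begin
      act (toList u) w                      ≡⟨ cong (act (toList u)) (sym (act-toList-1ᵛ w)) ⟩
      act (toList u) (act (toList w) 1ᵛ)    ≡⟨ act-comm (toList u) (toList w) 1ᵛ ⟩
      act (toList w) (act (toList u) 1ᵛ)    ≡⟨ cong (act (toList w)) (act-toList-1ᵛ u) ⟩
      act (toList w) u                      ∎

    ⊗-assoc : ∀ u v w → (u ⊗ v) ⊗ w ≡ u ⊗ (v ⊗ w)
    ⊗-assoc u v w = act-⊗ (toList u) v w

    ⊗-identityˡ : ∀ w → 1ᵛ ⊗ w ≡ w
    ⊗-identityˡ w = EvalAt.ev-1ᵛ w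

    ⊗-distribˡ : ∀ u v w → u ⊗ (v +ᵛ w) ≡ u ⊗ v +ᵛ u ⊗ w
    ⊗-distribˡ u v w = act-⊕ (toList u) v w

    ⊗-distribʳ : ∀ u v w → (u +ᵛ v) ⊗ w ≡ u ⊗ w +ᵛ v ⊗ w
    ⊗-distribʳ u v w = EvalAt.ev-+ᵛ w u v

    ⊗-mulX : ∀ v w → mulX v ⊗ w ≡ mulX (v ⊗ w)
    ⊗-mulX v w = EvalAt.ev-mulX w v

    ⊗-·ᵛ : ∀ a v w → (a ·ᵛ v) ⊗ w ≡ a ·ᵛ (v ⊗ w)
    ⊗-·ᵛ a v w = EvalAt.ev-·ᵛ w a v

    -- Long division by P, processing f from its top coefficient down:
    -- from  f = P·Q + R  one gets  a + x·f = P·(top R + x·Q) + (a + x·R - top R·P).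
    divide : Poly F → Poly F × Coords n
    divide []      = [] , 0ᵛ
    divide (a ∷ f) = let (Q , R) = divide f in (top R ∷ Q) , (mulX R +ᵛ a ·ᵛ 1ᵛ)

    quotient : Poly F → Poly F
    quotient f = proj₁ (divide f)

    remainder : Poly F → Coords n
    remainder f = proj₂ (divide f)

    division-identity : ∀ f → f ≈ P *ₚ quotient f +ₚ toList (remainder f)
    division-identity [] i = sym (begin
      coef (P *ₚ [] +ₚ toList 0ᵛ) i         ≡⟨ coef-+ (P *ₚ []) (toList 0ᵛ) i ⟩
      coef (P *ₚ []) i + coef (toList 0ᵛ) i ≡⟨ cong₂ _+_ (*ₚ-zeroʳ P i) (toList-0ᵛ i) ⟩
      0# + 0#                               ≡⟨ +-identityˡ 0# ⟩
      0#                                    ∎)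
      where
      *ₚ-zeroʳ : ∀ g i → coef (g *ₚ []) i ≡ 0#
      *ₚ-zeroʳ []      i = refl
      *ₚ-zeroʳ (a ∷ g) i = trans (coef-*-∷ˡ a g [] i) (trans (cong₂ _+_ (zeroʳ a) (shift-zero _ (*ₚ-zeroʳ g) i)) (+-identityˡ 0#))
    division-identity (a ∷ f) i = sym (begin
      coef (P *ₚ (t ∷ Q) +ₚ toList (mulX R +ᵛ a ·ᵛ 1ᵛ)) i
        ≡⟨ coef-+ (P *ₚ (t ∷ Q)) (toList (mulX R +ᵛ a ·ᵛ 1ᵛ)) i ⟩
      coef (P *ₚ (t ∷ Q)) i + coef (toList (mulX R +ᵛ a ·ᵛ 1ᵛ)) i
        ≡⟨ cong₂ _+_ (coef-*-∷ʳ P t Q i)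
            (trans (coef-toList (mulX R +ᵛ a ·ᵛ 1ᵛ) i) (trans (entry-+ᵛ (mulX R) (a ·ᵛ 1ᵛ) i)
               (cong₂ _+_ (entry-mulX R i) (trans (entry-·ᵛ a 1ᵛ i) (cong (a *_) (entry-1ᵛ i)))))) ⟩
      (t * coef P i + shift (coef (P *ₚ Q)) i) + ((shift (entry R) i + (- t) * coef P i) + a * coef [ 1# ] i)
        ≡⟨ solve 6 (λ t p s r nt e → ((t :* p :+ s) :+ ((r :+ nt :* p) :+ e)) := ((s :+ r :+ e) :+ (t :+ nt) :* p)) refl t (coef P i) _ _ (- t) _ ⟩
      (shift (coef (P *ₚ Q)) i + shift (entry R) i + a * coef [ 1# ] i) + (t + - t) * coef P i
        ≡⟨ +-zeroʳ _ (trans (cong (_* coef P i) (-‿inverseʳ t)) (zeroˡ _)) ⟩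
      shift (coef (P *ₚ Q)) i + shift (entry R) i + a * coef [ 1# ] i
        ≡⟨ step i ⟩
      coef (a ∷ f) i ∎)
      where
      Q : Poly F
      Q = quotient f
      R : Coords n
      R = remainder f
      t : Carrier
      t = top R
      step : ∀ i → shift (coef (P *ₚ Q)) i + shift (entry R) i + a * coef [ 1# ] i ≡ coef (a ∷ f) i
      step zero    = trans (cong₂ _+_ (+-identityˡ 0#) (*-identityʳ a)) (+-identityˡ a)
      step (suc j) = begin
        coef (P *ₚ Q) j + entry R j + a * 0#        ≡⟨ +-zeroʳ _ (zeroʳ a) ⟩
        coef (P *ₚ Q) j + entry R j                 ≡⟨ cong (coef (P *ₚ Q) j +_) (sym (coef-toList R j)) ⟩
        coef (P *ₚ Q) j + coef (toList R) j         ≡⟨ sym (coef-+ (P *ₚ Q) (toList R) j) ⟩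
        coef (P *ₚ Q +ₚ toList R) j                 ≡⟨ sym (division-identity f j) ⟩
        coef f j                                    ∎

  -- The annihilator lemma: if P = monic c of degree k is irreducible, z ≠ 0 lies
  -- in an F[x]-module and P(T) z = 0, then no nonzero polynomial of degree < k
  -- kills z.  A counterexample of least degree b, made monic (U), divides P:
  -- the remainder of P modulo U kills z and has degree < b, so it vanishes.
  -- As 1 ≤ b < k, P = U·Q would be a proper factorisation.
  module Annihilator (k′ : ℕ) (c : Coords (suc k′)) (irreducible : Irreducible F (monic c)) where
    k : ℕ
    k = suc k′

    P : Poly F
    P = monic c

    private module Rₖ = Residues k′ c

    no-proper-monic-factor : ∀ {b} (u : Coords b) → 1 ℕ.≤ b → b ℕ.< k → ∀ Q → monic u *ₚ Q ≈ P → ⊥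
    no-proper-monic-factor {b} u 1≤b b<k Q UQ≈P with proj₂ irreducible (monic u) Q UQ≈P
    ... | inj₁ U-constant = 0≢1 (trans (sym (U-constant b 1≤b)) (coef-monic-top u))
    ... | inj₂ Q-constant = 0≢1 (begin
      0#                           ≡⟨ sym (zeroˡ _) ⟩
      0# * coef Q 0                ≡⟨ cong (_* coef Q 0) (sym (coef-monic> u k b<k)) ⟩
      coef (monic u) k * coef Q 0  ≡⟨ sym (coef-*-top (monic u) Q k 0 (λ i lt → coef-monic> u i (ℕₚ.<-trans b<k lt)) Q-constant) ⟩
      coef (monic u *ₚ Q) (k ℕ.+ 0) ≡⟨ cong (coef (monic u *ₚ Q)) (ℕₚ.+-identityʳ k) ⟩
      coef (monic u *ₚ Q) k        ≡⟨ UQ≈P k ⟩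
      coef P k                     ≡⟨ coef-monic-top c ⟩
      1#                           ∎)

    module Normalise {b} (v : Coords k) (vanish : ∀ i → suc b ℕ.≤ i → entry v i ≡ 0#) (lead≢0 : entry v b ≢ 0#) where
      lead lead⁻¹ : Carrier
      lead   = entry v b
      lead⁻¹ = proj₁ (inverse lead lead≢0)

      lead*lead⁻¹ : lead * lead⁻¹ ≡ 1#
      lead*lead⁻¹ = proj₂ (inverse lead lead≢0)

      b<k : b ℕ.< k
      b<k with b ℕ.<? k
      ... | yes lt = lt
      ... | no ¬lt = ⊥-elim (lead≢0 (entry-beyond v b (ℕₚ.≮⇒≥ ¬lt)))

      normalised : Coords b
      normalised = fromSeq b (λ i → lead⁻¹ * entry v i)

      normalised-≈ : toList v ≈ lead ·ₚ monic normalised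
      normalised-≈ i with ℕₚ.<-cmp i b
      ... | tri< i<b _ _ = begin
        coef (toList v) i                ≡⟨ coef-toList v i ⟩
        entry v i                        ≡⟨ sym (*-identityˡ _) ⟩
        1# * entry v i                   ≡⟨ cong (_* entry v i) (sym lead*lead⁻¹) ⟩
        (lead * lead⁻¹) * entry v i      ≡⟨ *-assoc _ _ _ ⟩
        lead * (lead⁻¹ * entry v i)      ≡⟨ cong (lead *_) (sym (trans (coef-monic< normalised i i<b) (entry-fromSeq< b _ i i<b))) ⟩
        lead * coef (monic normalised) i ≡⟨ sym (coef-· lead (monic normalised) i) ⟩
        coef (lead ·ₚ monic normalised) i ∎
      ... | tri≈ _ refl _ = begin
        coef (toList v) i                 ≡⟨ coef-toList v i ⟩
        lead                              ≡⟨ sym (*-identityʳ lead) ⟩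
        lead * 1#                         ≡⟨ cong (lead *_) (sym (coef-monic-top normalised)) ⟩
        lead * coef (monic normalised) i  ≡⟨ sym (coef-· lead (monic normalised) i) ⟩
        coef (lead ·ₚ monic normalised) i ∎
      ... | tri> _ _ i>b = begin
        coef (toList v) i                 ≡⟨ coef-toList v i ⟩
        entry v i                         ≡⟨ vanish i i>b ⟩
        0#                                ≡⟨ sym (zeroʳ lead) ⟩
        lead * 0#                         ≡⟨ cong (lead *_) (sym (coef-monic> normalised i i>b)) ⟩
        lead * coef (monic normalised) i  ≡⟨ sym (coef-· lead (monic normalised) i) ⟩
        coef (lead ·ₚ monic normalised) i ∎

    module _ (𝕄 : FxModule) (z : FxModule.M 𝕄) (z≢0 : z ≢ FxModule.0ᴹ 𝕄)
             (Pz≡0 : FxModuleTheory.act 𝕄 P z ≡ FxModule.0ᴹ 𝕄) where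
      open FxModule 𝕄
      open FxModuleTheory 𝕄

      NoAnnihilatorBelow : ℕ → Set
      NoAnnihilatorBelow b = ∀ (w : Coords k) → (∀ i → b ℕ.≤ i → entry w i ≡ 0#) → act (toList w) z ≡ 0ᴹ → w ≡ Rₖ.0ᵛ

      -- the remainder of P modulo a monic annihilator U of degree b kills z,
      -- hence vanishes by minimality, so U divides P
      monic-annihilator-divides : ∀ b′ (u : Coords (suc b′)) → suc b′ ℕ.< k → act (monic u) z ≡ 0ᴹ →
                                  NoAnnihilatorBelow (suc b′) → monic u *ₚ Residues.quotient b′ u P ≈ P
      monic-annihilator-divides b′ u b<k Uz≡0 minimal i = sym (begin
        coef P i                        ≡⟨ split i ⟩
        coef (U *ₚ Q +ₚ toList R) i     ≡⟨ coef-+ (U *ₚ Q) (toList R) i ⟩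
        coef (U *ₚ Q) i + coef (toList R) i ≡⟨ +-zeroʳ _ (R≈0 i) ⟩
        coef (U *ₚ Q) i                 ∎)
        where
        module Rᵤ = Residues b′ u
        U = monic u
        Q = Rᵤ.quotient P
        R = Rᵤ.remainder P
        split : P ≈ U *ₚ Q +ₚ toList R
        split = Rᵤ.division-identity P
        Rz≡0 : act (toList R) z ≡ 0ᴹ
        Rz≡0 = begin
          act (toList R) z                        ≡⟨ sym (⊕-idˡ _) ⟩
          0ᴹ ⊕ act (toList R) z                   ≡⟨ cong (_⊕ act (toList R) z) (sym (begin
              act (U *ₚ Q) z    ≡⟨ act-*ₚ U Q z ⟩
              act U (act Q z)   ≡⟨ act-comm U Q z ⟩
              act Q (act U z)   ≡⟨ cong (act Q) Uz≡0 ⟩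
              act Q 0ᴹ          ≡⟨ act-0 Q ⟩
              0ᴹ                ∎)) ⟩
          act (U *ₚ Q) z ⊕ act (toList R) z        ≡⟨ sym (act-+ₚ (U *ₚ Q) (toList R) z) ⟩
          act (U *ₚ Q +ₚ toList R) z               ≡⟨ sym (act-cong P (U *ₚ Q +ₚ toList R) split z) ⟩
          act P z                                  ≡⟨ Pz≡0 ⟩
          0ᴹ                                       ∎
        R′ : Coords k
        R′ = fromSeq k (entry R)
        entry-R′ : ∀ i → entry R′ i ≡ entry R i
        entry-R′ = entry-fromSeq k (entry R) (λ i le → entry-beyond R i (ℕₚ.≤-trans (ℕₚ.<⇒≤ b<k) le))
        R′≈R : toList R′ ≈ toList R
        R′≈R i = trans (coef-toList R′ i) (trans (entry-R′ i) (sym (coef-toList R i)))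
        R′≡0 : R′ ≡ Rₖ.0ᵛ
        R′≡0 = minimal R′ (λ i le → trans (entry-R′ i) (entry-beyond R i le))
                          (trans (act-cong (toList R′) (toList R) R′≈R z) Rz≡0)
        R≈0 : ∀ i → coef (toList R) i ≡ 0#
        R≈0 i = trans (sym (R′≈R i)) (trans (coef-toList R′ i) (trans (cong (λ w → entry w i) R′≡0) (Rₖ.entry-0ᵛ i)))

      no-annihilator-of-degree : ∀ b (v : Coords k) → (∀ i → suc b ℕ.≤ i → entry v i ≡ 0#) → act (toList v) z ≡ 0ᴹ →
                                 entry v b ≢ 0# → NoAnnihilatorBelow b → ⊥
      no-annihilator-of-degree b v vanish vz≡0 lead≢0 minimal = by-degree b refl
        where
        open Normalise v vanish lead≢0
        Uz≡0 : act (monic normalised) z ≡ 0ᴹ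
        Uz≡0 = begin
          act U z                       ≡⟨ sym (⊙-one _) ⟩
          1# ⊙ act U z                  ≡⟨ cong (_⊙ act U z) (sym (trans (*-comm lead⁻¹ lead) lead*lead⁻¹)) ⟩
          (lead⁻¹ * lead) ⊙ act U z     ≡⟨ ⊙-assoc lead⁻¹ lead _ ⟩
          lead⁻¹ ⊙ (lead ⊙ act U z)     ≡⟨ cong (lead⁻¹ ⊙_) (sym (trans (act-cong (toList v) (lead ·ₚ U) normalised-≈ z) (act-·ₚ lead U z))) ⟩
          lead⁻¹ ⊙ act (toList v) z     ≡⟨ cong (lead⁻¹ ⊙_) vz≡0 ⟩
          lead⁻¹ ⊙ 0ᴹ                   ≡⟨ ⊙-zeroʳ lead⁻¹ ⟩
          0ᴹ                            ∎
          where U = monic normalised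
        by-degree : ∀ b′ → b′ ≡ b → ⊥
        by-degree zero     refl = z≢0 (trans (sym (act-1 z)) Uz≡0)
        by-degree (suc b′) refl = no-proper-monic-factor normalised (s≤s z≤n) b<k (Residues.quotient b′ normalised P)
                                    (monic-annihilator-divides b′ normalised b<k Uz≡0 minimal)

      no-annihilator-below : ∀ b → NoAnnihilatorBelow b
      no-annihilator-below zero v vanish vz≡0 = Rₖ.entrywise (λ i → trans (vanish i z≤n) (sym (Rₖ.entry-0ᵛ i)))
      no-annihilator-below (suc b) v vanish vz≡0 with entry v b ≟ 0#
      ... | no lead≢0 = ⊥-elim (no-annihilator-of-degree b v vanish vz≡0 lead≢0 (no-annihilator-below b))
      ... | yes lead≡0 = no-annihilator-below b v vanish′ vz≡0
        where
        vanish′ : ∀ i → b ℕ.≤ i → entry v i ≡ 0#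
        vanish′ i b≤i with ℕₚ.m≤n⇒m<n∨m≡n b≤i
        ... | inj₁ b<i  = vanish i b<i
        ... | inj₂ refl = lead≡0

      no-small-annihilator : ∀ (v : Coords k) → act (toList v) z ≡ 0ᴹ → v ≡ Rₖ.0ᵛ
      no-small-annihilator v = no-annihilator-below k v (entry-beyond v)

  -- F itself as an F[x]-module in which x acts as 1: here f(T) 1 = f(1).
  scalarModule : FxModule
  scalarModule = record
    { M = Carrier ; _⊕_ = _+_ ; 0ᴹ = 0# ; _⊙_ = _*_ ; T = 1# *_
    ; ⊕-assoc = +-assoc ; ⊕-comm = +-comm ; ⊕-idˡ = +-identityˡ
    ; ⊙-distˡ = distribˡ ; ⊙-distʳ = λ a b x → distribʳ x a b ; ⊙-assoc = *-assoc
    ; ⊙-one = *-identityˡ ; ⊙-zero = zeroˡ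
    ; T-⊕ = distribˡ 1#
    ; T-⊙ = λ a x → solve 2 (λ a x → (con 1 :* (a :* x)) := (a :* (con 1 :* x))) refl a x }
  module Scalar = FxModuleTheory scalarModule

  act-scalar≡eval : ∀ f → Scalar.act f 1# ≡ eval F f 1#
  act-scalar≡eval []      = refl
  act-scalar≡eval (a ∷ f) = cong₂ _+_ (*-identityʳ a) (cong (1# *_) (act-scalar≡eval f))

  -- the value at 1 of the polynomial of a vector, i.e. the sum of its entries
  valueAt1 : ∀ {m} → Coords m → Carrier
  valueAt1 v = Scalar.act (toList v) 1#

  valueAt1-∷ : ∀ {m} a (w : Coords m) → valueAt1 (a ∷ w) ≡ a + valueAt1 w
  valueAt1-∷ a w = cong₂ _+_ (*-identityʳ a) (*-identityˡ _)

  open Inverse card using (to; from; strictlyInverseˡ; strictlyInverseʳ)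

  elements : List Carrier
  elements = map from (allFin q)

  elements-complete : ∀ a → a ∈ elements
  elements-complete a = subst (_∈ elements) (strictlyInverseʳ a) (∈-map⁺ from (∈-allFin (to a)))

  elements-unique : Unique elements
  elements-unique = Unique.map⁺ (λ {i} {j} e → trans (sym (strictlyInverseˡ i)) (trans (cong to e) (strictlyInverseˡ j)))
                                (Unique.allFin⁺ q)

  elements-length : length elements ≡ q
  elements-length = trans (Listₚ.length-map from (allFin q)) (Listₚ.length-tabulate (λ i → i))

  prepend : ∀ {m} → Carrier → Coords m → Coords (suc m)
  prepend = Vec._∷_

  vectors : ∀ m → List (Coords m)
  vectors zero    = [ [] ]
  vectors (suc m) = cartesianProductWith prepend elements (vectors m)

  vectors-complete : ∀ m (v : Coords m) → v ∈ vectors m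
  vectors-complete zero    []      = here refl
  vectors-complete (suc m) (a ∷ v) = ∈-cartesianProductWith⁺ prepend (elements-complete a) (vectors-complete m v)

  vectors-unique : ∀ m → Unique (vectors m)
  vectors-unique zero    = All.[] AllPairs.∷ AllPairs.[]
  vectors-unique (suc m) = Unique.cartesianProductWith⁺ prepend (λ e → ∷-injectiveˡ e , ∷-injectiveʳ e)
                                                         elements-unique (vectors-unique m)

  length-product : ∀ {m} (xs : List Carrier) (ys : List (Coords m)) →
                   length (cartesianProductWith prepend xs ys) ≡ length xs ℕ.* length ys
  length-product []       ys = refl
  length-product (x ∷ xs) ys = trans (Listₚ.length-++ (map (prepend x) ys))
                                     (cong₂ ℕ._+_ (Listₚ.length-map (prepend x) ys) (length-product xs ys))

  vectors-length : ∀ m → length (vectors m) ≡ q ℕ.^ m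
  vectors-length zero    = refl
  vectors-length (suc m) = trans (length-product elements (vectors m)) (cong₂ ℕ._*_ elements-length (vectors-length m))

  coords↔Fin : ∀ m → Coords m ↔ Fin (q ℕ.^ m)
  coords↔Fin zero    = ↔-sym (↔-trans 1↔⊤ (mk↔ₛ′ (λ _ → []) (λ _ → tt) (λ { [] → refl }) (λ _ → refl)))
  coords↔Fin (suc m) = ↔-trans uncons (↔-trans (card ×-↔ coords↔Fin m) (↔-sym (*↔× {q})))
    where
    uncons : Coords (suc m) ↔ (Carrier × Coords m)
    uncons = mk↔ₛ′ (λ { (a ∷ v) → a , v }) (λ (a , v) → a ∷ v) (λ _ → refl) (λ { (a ∷ v) → refl })

  module CountCoords (m : ℕ) = ListCounting {Coords m} (≡-dec _≟_)
  module CountElements = ListCounting {Carrier} _≟_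

  -- Exactly q^m vectors of F^(m+1) have any prescribed value t at 1: the first
  -- entry a is free and the remaining entries must have value t - a.
  module _ where
    private
      sumOver : List Carrier → (Carrier → ℕ) → ℕ
      sumOver []       f = 0
      sumOver (x ∷ xs) f = f x ℕ.+ sumOver xs f

      sumOver-const : ∀ xs f c → (∀ x → f x ≡ c) → sumOver xs f ≡ length xs ℕ.* c
      sumOver-const []       f c e = refl
      sumOver-const (x ∷ xs) f c e = cong₂ ℕ._+_ (e x) (sumOver-const xs f c e)

      count-map-∷ : ∀ {m} {Q : Pred (Coords (suc m)) 0ℓ} (Q? : Decidable Q) x (ys : List (Coords m)) →
                    CountCoords.count (suc m) Q? (map (prepend x) ys) ≡ CountCoords.count m (λ w → Q? (x ∷ w)) ys
      count-map-∷ Q? x [] = refl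
      count-map-∷ Q? x (y ∷ ys) with Q? (x ∷ y)
      ... | yes _ = cong suc (count-map-∷ Q? x ys)
      ... | no  _ = count-map-∷ Q? x ys

      count-product : ∀ {m} {Q : Pred (Coords (suc m)) 0ℓ} (Q? : Decidable Q) xs (ys : List (Coords m)) →
                      CountCoords.count (suc m) Q? (cartesianProductWith prepend xs ys)
                        ≡ sumOver xs (λ x → CountCoords.count m (λ w → Q? (x ∷ w)) ys)
      count-product Q? []       ys = refl
      count-product Q? (x ∷ xs) ys = trans (cong length (Listₚ.filter-++ Q? (map (prepend x) ys) _))
        (trans (Listₚ.length-++ (filter Q? (map (prepend x) ys))) (cong₂ ℕ._+_ (count-map-∷ Q? x ys) (count-product Q? xs ys)))

      count-≐ : ∀ {A : Set} {Q R : Pred A 0ℓ} (Q? : Decidable Q) (R? : Decidable R) →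
                (∀ v → Q v → R v) → (∀ v → R v → Q v) → ∀ xs → length (filter Q? xs) ≡ length (filter R? xs)
      count-≐ Q? R? QR RQ xs = cong length (Listₚ.filter-≐ Q? R? ((λ {v} → QR v) , (λ {v} → RQ v)) xs)

    count-valueAt1 : ∀ m t → CountCoords.count (suc m) (λ v → valueAt1 v ≟ t) (vectors (suc m)) ≡ q ℕ.^ m
    count-valueAt1 zero t = begin
      CountCoords.count 1 (λ v → valueAt1 v ≟ t) (vectors 1)
        ≡⟨ count-product (λ v → valueAt1 v ≟ t) elements (vectors 0) ⟩
      sumOver elements (λ x → CountCoords.count 0 (λ w → valueAt1 (x ∷ w) ≟ t) [ [] ])
        ≡⟨ singletons elements ⟩
      CountElements.count (λ x → valueAt1 (x ∷ []) ≟ t) elements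
        ≡⟨ count-≐ (λ x → valueAt1 (x ∷ []) ≟ t) (_≟ t) (λ x e → trans (sym (trans (valueAt1-∷ x []) (+-identityʳ x))) e)
                                                           (λ x e → trans (trans (valueAt1-∷ x []) (+-identityʳ x)) e) elements ⟩
      CountElements.count (_≟ t) elements
        ≡⟨ CountElements.count-once t elements elements-unique (elements-complete t) ⟩
      1 ∎
      where
      singletons : ∀ xs → sumOver xs (λ x → CountCoords.count 0 (λ w → valueAt1 (x ∷ w) ≟ t) [ [] ])
                          ≡ CountElements.count (λ x → valueAt1 (x ∷ []) ≟ t) xs
      singletons [] = refl
      singletons (x ∷ xs) with valueAt1 (x ∷ []) ≟ t
      ... | yes _ = cong suc (singletons xs)
      ... | no  _ = singletons xs
    count-valueAt1 (suc m) t = begin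
      CountCoords.count (suc (suc m)) (λ v → valueAt1 v ≟ t) (vectors (suc (suc m)))
        ≡⟨ count-product (λ v → valueAt1 v ≟ t) elements (vectors (suc m)) ⟩
      sumOver elements (λ x → CountCoords.count (suc m) (λ w → valueAt1 (x ∷ w) ≟ t) (vectors (suc m)))
        ≡⟨ sumOver-const elements _ (q ℕ.^ m) each ⟩
      length elements ℕ.* q ℕ.^ m
        ≡⟨ cong (ℕ._* q ℕ.^ m) elements-length ⟩
      q ℕ.^ suc m ∎
      where
      each : ∀ x → CountCoords.count (suc m) (λ w → valueAt1 (x ∷ w) ≟ t) (vectors (suc m)) ≡ q ℕ.^ m
      each x = trans (count-≐ (λ w → valueAt1 (x ∷ w) ≟ t) (λ w → valueAt1 w ≟ (- x + t))
        (λ w e → begin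
          valueAt1 w                  ≡⟨ sym (+-identityˡ _) ⟩
          0# + valueAt1 w             ≡⟨ cong (_+ valueAt1 w) (sym (-‿inverseˡ x)) ⟩
          (- x + x) + valueAt1 w      ≡⟨ +-assoc _ _ _ ⟩
          - x + (x + valueAt1 w)      ≡⟨ cong (- x +_) (trans (sym (valueAt1-∷ x w)) e) ⟩
          - x + t                     ∎)
        (λ w e → begin
          valueAt1 (x ∷ w)            ≡⟨ valueAt1-∷ x w ⟩
          x + valueAt1 w              ≡⟨ cong (x +_) e ⟩
          x + (- x + t)               ≡⟨ sym (+-assoc _ _ _) ⟩
          (x + - x) + t               ≡⟨ cong (_+ t) (-‿inverseʳ x) ⟩
          0# + t                      ≡⟨ +-identityˡ t ⟩
          t                           ∎) (vectors (suc m)))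
        (count-valueAt1 m (- x + t))

  weight-∷ : ∀ a f → weight F (a ∷ f) ≡ indicator (¬? (a ≟ 0#)) ℕ.+ weight F f
  weight-∷ a f with a ≟ 0#
  ... | yes _ = refl
  ... | no  _ = refl

  weight-cong : ∀ f g → f ≈ g → weight F f ≡ weight F g
  weight-cong []      []      e = refl
  weight-cong []      (b ∷ g) e = trans (weight-cong [] g (λ n → e (suc n)))
    (sym (trans (weight-∷ b g) (cong (ℕ._+ weight F g) (indicator-cong (¬? (b ≟ 0#)) (no (λ ())) (λ b≢0 → b≢0 (sym (e 0))) λ ()))))
  weight-cong (a ∷ f) []      e = trans (trans (weight-∷ a f)
    (cong (ℕ._+ weight F f) (indicator-cong (¬? (a ≟ 0#)) (no (λ ())) (λ a≢0 → a≢0 (e 0)) λ ()))) (weight-cong f [] (λ n → e (suc n)))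
  weight-cong (a ∷ f) (b ∷ g) e = trans (weight-∷ a f) (trans (cong₂ ℕ._+_
    (indicator-cong (¬? (a ≟ 0#)) (¬? (b ≟ 0#)) (λ a≢0 b≡0 → a≢0 (trans (e 0) b≡0)) (λ b≢0 a≡0 → b≢0 (trans (sym (e 0)) a≡0)))
    (weight-cong f g (λ n → e (suc n)))) (sym (weight-∷ b g)))

  geometric : ℕ → Poly F
  geometric m = replicate m 1#

  coef-geometric< : ∀ m i → i ℕ.< m → coef (geometric m) i ≡ 1#
  coef-geometric< (suc m) zero    _         = refl
  coef-geometric< (suc m) (suc i) (s≤s lt) = coef-geometric< m i lt

  coef-geometric≥ : ∀ m i → m ℕ.≤ i → coef (geometric m) i ≡ 0#
  coef-geometric≥ zero    i       _         = refl
  coef-geometric≥ (suc m) (suc i) (s≤s le) = coef-geometric≥ m i le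

  xPower : ℕ → Poly F
  xPower m = replicate m 0# ++ [ 1# ]

  coef-xPower< : ∀ m i → i ℕ.< m → coef (xPower m) i ≡ 0#
  coef-xPower< (suc m) zero    _         = refl
  coef-xPower< (suc m) (suc i) (s≤s lt) = coef-xPower< m i lt

  coef-xPower-top : ∀ m → coef (xPower m) m ≡ 1#
  coef-xPower-top zero    = refl
  coef-xPower-top (suc m) = coef-xPower-top m

  coef-xPower> : ∀ m i → m ℕ.< i → coef (xPower m) i ≡ 0#
  coef-xPower> zero    (suc i) _         = refl
  coef-xPower> (suc m) (suc i) (s≤s lt) = coef-xPower> m i lt

  coef-[x-1]* : ∀ h i → coef (x-1 F *ₚ h) i ≡ - coef h i + shift (coef h) i
  coef-[x-1]* h i = begin
    coef (x-1 F *ₚ h) i                            ≡⟨ coef-*-∷ˡ (- 1#) (1# ∷ []) h i ⟩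
    (- 1#) * coef h i + shift (coef ([ 1# ] *ₚ h)) i ≡⟨ cong₂ _+_ (-1*x≈-x _) (shift-cong 1*h≈h i) ⟩
    - coef h i + shift (coef h) i                  ∎
    where
    1*h≈h : ∀ j → coef ([ 1# ] *ₚ h) j ≡ coef h j
    1*h≈h j = trans (coef-*-∷ˡ 1# [] h j) (trans (+-zeroʳ _ (shift-zero _ (λ _ → refl) j)) (*-identityˡ _))

  [x-1]*geometric : ∀ m → 1 ℕ.≤ m → x-1 F *ₚ geometric m ≈ xᵐ-1 F m
  [x-1]*geometric m 1≤m i = trans (coef-[x-1]* (geometric m) i)
    (trans (telescope i) (sym (coef-+ (xPower m) [ - 1# ] i)))
    where
    telescope : ∀ i → - coef (geometric m) i + shift (coef (geometric m)) i ≡ coef (xPower m) i + coef [ - 1# ] i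
    telescope zero = begin
      - coef (geometric m) 0 + 0#  ≡⟨ +-identityʳ _ ⟩
      - coef (geometric m) 0       ≡⟨ cong -_ (coef-geometric< m 0 1≤m) ⟩
      - 1#                         ≡⟨ sym (+-identityˡ _) ⟩
      0# + - 1#                    ≡⟨ cong (_+ - 1#) (sym (coef-xPower< m 0 1≤m)) ⟩
      coef (xPower m) 0 + - 1#     ∎
    telescope (suc i) with ℕₚ.<-cmp (suc i) m
    ... | tri< lt _ _ = begin
      - coef (geometric m) (suc i) + coef (geometric m) i
        ≡⟨ cong₂ (λ a b → - a + b) (coef-geometric< m (suc i) lt) (coef-geometric< m i (ℕₚ.<-trans (ℕₚ.n<1+n i) lt)) ⟩
      - 1# + 1#                    ≡⟨ -‿inverseˡ 1# ⟩
      0#                           ≡⟨ sym (+-identityʳ 0#) ⟩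
      0# + 0#                      ≡⟨ cong (_+ 0#) (sym (coef-xPower< m (suc i) lt)) ⟩
      coef (xPower m) (suc i) + 0# ∎
    ... | tri≈ _ refl _ = begin
      - coef (geometric m) (suc i) + coef (geometric m) i
        ≡⟨ cong₂ (λ a b → - a + b) (coef-geometric≥ m (suc i) ℕₚ.≤-refl) (coef-geometric< m i (ℕₚ.n<1+n i)) ⟩
      - 0# + 1#                    ≡⟨ trans (cong (_+ 1#) -0#≈0#) (+-identityˡ 1#) ⟩
      1#                           ≡⟨ sym (+-identityʳ 1#) ⟩
      1# + 0#                      ≡⟨ cong (_+ 0#) (sym (coef-xPower-top m)) ⟩
      coef (xPower m) (suc i) + 0# ∎
    ... | tri> _ _ gt = begin
      - coef (geometric m) (suc i) + coef (geometric m) i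
        ≡⟨ cong₂ (λ a b → - a + b) (coef-geometric≥ m (suc i) (ℕₚ.<⇒≤ gt)) (coef-geometric≥ m i (ℕₚ.≤-pred gt)) ⟩
      - 0# + 0#                    ≡⟨ trans (cong (_+ 0#) -0#≈0#) (+-identityˡ 0#) ⟩
      0#                           ≡⟨ sym (+-identityʳ 0#) ⟩
      0# + 0#                      ≡⟨ cong (_+ 0#) (sym (coef-xPower> m (suc i) gt)) ⟩
      coef (xPower m) (suc i) + 0# ∎

  [x-1]*h≈xᵐ-1⇒h≈geometric : ∀ m → 1 ℕ.≤ m → ∀ h → x-1 F *ₚ h ≈ xᵐ-1 F m → h ≈ geometric m
  [x-1]*h≈xᵐ-1⇒h≈geometric m 1≤m h e = monic-*ₚ-cancelˡ (x-1 F) 1 refl x-1-above h (geometric m)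
    (≈-trans {x-1 F *ₚ h} {xᵐ-1 F m} {x-1 F *ₚ geometric m} e (≈-sym {x-1 F *ₚ geometric m} {xᵐ-1 F m} ([x-1]*geometric m 1≤m)))
    where
    x-1-above : ∀ i → 1 ℕ.< i → coef (x-1 F) i ≡ 0#
    x-1-above (suc (suc i)) _               = refl
    x-1-above (suc zero)    (s≤s ())

  module Primitivity (k′ : ℕ) (c : Coords (suc k′)) (irreducible : Irreducible F (monic c))
                     (P[1]≢0 : eval F (monic c) 1# ≢ 0#) where
    k : ℕ
    k = suc k′

    open Residues k′ c
    open Annihilator k′ c irreducible using (no-small-annihilator)
    private module 𝕽 = FxModule residueModule

    open Iteration mulX 1ᵛ renaming (iterate to αPower)

    Q : ℕ → Poly F
    Q j = quotient (geometric j)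

    W : ℕ → Coords k
    W j = remainder (geometric j)

    -- G_(j+1) = 1 + x·G_j: the two ways of reducing it agree
    remainder-step : ∀ j → mulX (W j) +ᵛ 1ᵛ ≡ W j +ᵛ αPower j
    remainder-step zero    = cong (_+ᵛ 1ᵛ) T-0
    remainder-step (suc j) = begin
      mulX (x·W +ᵛ 1# ·ᵛ 1ᵛ) +ᵛ 1ᵛ          ≡⟨ cong (λ z → mulX (x·W +ᵛ z) +ᵛ 1ᵛ) (𝕽.⊙-one 1ᵛ) ⟩
      mulX (x·W +ᵛ 1ᵛ) +ᵛ 1ᵛ                ≡⟨ cong (_+ᵛ 1ᵛ) (trans (cong mulX (remainder-step j)) (mulX-+ᵛ (W j) (αPower j))) ⟩
      (x·W +ᵛ mulX (αPower j)) +ᵛ 1ᵛ        ≡⟨ 𝕽.⊕-assoc x·W (mulX (αPower j)) 1ᵛ ⟩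
      x·W +ᵛ (mulX (αPower j) +ᵛ 1ᵛ)        ≡⟨ cong (x·W +ᵛ_) (𝕽.⊕-comm (mulX (αPower j)) 1ᵛ) ⟩
      x·W +ᵛ (1ᵛ +ᵛ mulX (αPower j))        ≡⟨ sym (𝕽.⊕-assoc x·W 1ᵛ (mulX (αPower j))) ⟩
      (x·W +ᵛ 1ᵛ) +ᵛ mulX (αPower j)        ≡⟨ cong (λ z → (x·W +ᵛ z) +ᵛ mulX (αPower j)) (sym (𝕽.⊙-one 1ᵛ)) ⟩
      (x·W +ᵛ 1# ·ᵛ 1ᵛ) +ᵛ mulX (αPower j)  ∎
      where
      x·W : Coords k
      x·W = mulX (W j)

    P[1] : Carrier
    P[1] = Scalar.act P 1#

    P[1]-nonzero : P[1] ≢ 0#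
    P[1]-nonzero e = P[1]≢0 (trans (sym (act-scalar≡eval P)) e)

    valueAt1-+ᵛ : ∀ v w → valueAt1 (v +ᵛ w) ≡ valueAt1 v + valueAt1 w
    valueAt1-+ᵛ v w = trans (Scalar.act-cong (toList (v +ᵛ w)) (toList v +ₚ toList w) (toList-+ᵛ v w) 1#)
                            (Scalar.act-+ₚ (toList v) (toList w) 1#)

    valueAt1-1ᵛ : valueAt1 1ᵛ ≡ 1#
    valueAt1-1ᵛ = trans (Scalar.act-cong (toList 1ᵛ) [ 1# ] toList-1ᵛ 1#) (Scalar.act-1 1#)

    valueAt1-0ᵛ : valueAt1 0ᵛ ≡ 0#
    valueAt1-0ᵛ = Scalar.act-cong (toList 0ᵛ) [] toList-0ᵛ 1#

    -- reduction subtracts top(v)·P, whose value at 1 is top(v)·P(1)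
    valueAt1-mulX : ∀ v → valueAt1 (mulX v) ≡ valueAt1 v + (- top v) * P[1]
    valueAt1-mulX v = begin
      Scalar.act (toList (mulX v)) 1#                         ≡⟨ Scalar.act-cong (toList (mulX v)) ((0# ∷ toList v) +ₚ (- top v) ·ₚ P) (mulX-poly v) 1# ⟩
      Scalar.act ((0# ∷ toList v) +ₚ (- top v) ·ₚ P) 1#       ≡⟨ Scalar.act-+ₚ (0# ∷ toList v) ((- top v) ·ₚ P) 1# ⟩
      Scalar.act (0# ∷ toList v) 1# + Scalar.act ((- top v) ·ₚ P) 1#
        ≡⟨ cong₂ _+_ (trans (Scalar.act-x* (toList v) 1#) (*-identityˡ _)) (Scalar.act-·ₚ (- top v) P 1#) ⟩
      valueAt1 v + (- top v) * P[1]                           ∎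

    top-remainder-identity : ∀ j → top (W j) * P[1] + valueAt1 (αPower j) ≡ 1#
    top-remainder-identity j = begin
      t * P[1] + a                          ≡⟨ cong (t * P[1] +_) a≡ ⟩
      t * P[1] + ((- t) * P[1] + 1#)        ≡⟨ cong (λ z → t * P[1] + (z + 1#)) (sym (-‿distribˡ-* t P[1])) ⟩
      t * P[1] + (- (t * P[1]) + 1#)        ≡⟨ sym (+-assoc _ _ _) ⟩
      (t * P[1] + - (t * P[1])) + 1#        ≡⟨ cong (_+ 1#) (-‿inverseʳ _) ⟩
      0# + 1#                               ≡⟨ +-identityˡ 1# ⟩
      1#                                    ∎
      where
      t = top (W j)
      a = valueAt1 (αPower j)
      s = valueAt1 (W j)
      a≡ : a ≡ (- t) * P[1] + 1#
      a≡ = sym (+-cancelˡ s _ _ (begin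
        s + ((- t) * P[1] + 1#)       ≡⟨ sym (+-assoc _ _ _) ⟩
        s + (- t) * P[1] + 1#         ≡⟨ cong₂ _+_ (sym (valueAt1-mulX (W j))) (sym valueAt1-1ᵛ) ⟩
        valueAt1 (mulX (W j)) + valueAt1 1ᵛ ≡⟨ sym (valueAt1-+ᵛ (mulX (W j)) 1ᵛ) ⟩
        valueAt1 (mulX (W j) +ᵛ 1ᵛ)   ≡⟨ cong valueAt1 (remainder-step j) ⟩
        valueAt1 (W j +ᵛ αPower j)    ≡⟨ valueAt1-+ᵛ (W j) (αPower j) ⟩
        s + a                         ∎))

    top≡0⇒hit : ∀ j → top (W j) ≡ 0# → valueAt1 (αPower j) ≡ 1#
    top≡0⇒hit j t≡0 = trans (sym (trans (cong (λ z → z * P[1] + valueAt1 (αPower j)) t≡0)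
                                        (trans (cong (_+ valueAt1 (αPower j)) (zeroˡ P[1])) (+-identityˡ _))))
                            (top-remainder-identity j)

    hit⇒top≡0 : ∀ j → valueAt1 (αPower j) ≡ 1# → top (W j) ≡ 0#
    hit⇒top≡0 j hit with top (W j) ≟ 0#
    ... | yes t≡0 = t≡0
    ... | no  t≢0 = ⊥-elim (nonzero-* _ _ t≢0 P[1]-nonzero (+-cancelʳ 1# _ _ (begin
      top (W j) * P[1] + 1#                    ≡⟨ cong (top (W j) * P[1] +_) (sym hit) ⟩
      top (W j) * P[1] + valueAt1 (αPower j)   ≡⟨ top-remainder-identity j ⟩
      1#                                       ≡⟨ sym (+-identityˡ 1#) ⟩
      0# + 1#                                  ∎)))

    Hit? : ∀ i → Dec (valueAt1 (αPower i) ≡ 1#)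
    Hit? i = valueAt1 (αPower i) ≟ 1#

    -- Q_(j+1) = t_j + x·Q_j, so the weight of Q_j counts the misses below j
    weight-Q : ∀ j → weight F (Q j) ≡ countBelow (λ i → ¬? (Hit? i)) j
    weight-Q zero    = refl
    weight-Q (suc j) = trans (weight-∷ (top (W j)) (Q j)) (cong₂ ℕ._+_
      (indicator-cong (¬? (top (W j) ≟ 0#)) (¬? (Hit? j)) (λ t≢0 hit → t≢0 (hit⇒top≡0 j hit)) (λ miss t≡0 → miss (top≡0⇒hit j t≡0)))
      (weight-Q j))

    remainder-zero⇒divides : ∀ m → W m ≡ 0ᵛ → P *ₚ Q m ≈ geometric m
    remainder-zero⇒divides m W≡0 i = sym (begin
      coef (geometric m) i                        ≡⟨ division-identity (geometric m) i ⟩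
      coef (P *ₚ Q m +ₚ toList (W m)) i           ≡⟨ coef-+ (P *ₚ Q m) (toList (W m)) i ⟩
      coef (P *ₚ Q m) i + coef (toList (W m)) i   ≡⟨ +-zeroʳ _ (trans (coef-toList (W m) i) (trans (cong (λ z → entry z i) W≡0) (entry-0ᵛ i))) ⟩
      coef (P *ₚ Q m) i                           ∎)

    -- W_m = G_m(α) = (P·g)(α) = 0
    divides⇒remainder-zero : ∀ m g → P *ₚ g ≈ geometric m → W m ≡ 0ᵛ
    divides⇒remainder-zero m g Pg≈G = begin
      W m                                               ≡⟨ sym (act-toList-1ᵛ (W m)) ⟩
      act (toList (W m)) 1ᵛ                             ≡⟨ sym (𝕽.⊕-idˡ _) ⟩
      0ᵛ +ᵛ act (toList (W m)) 1ᵛ                       ≡⟨ cong (_+ᵛ act (toList (W m)) 1ᵛ) (sym (trans (act-*ₚ P (Q m) 1ᵛ) (P-kills _))) ⟩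
      act (P *ₚ Q m) 1ᵛ +ᵛ act (toList (W m)) 1ᵛ        ≡⟨ sym (act-+ₚ (P *ₚ Q m) (toList (W m)) 1ᵛ) ⟩
      act (P *ₚ Q m +ₚ toList (W m)) 1ᵛ                 ≡⟨ sym (act-cong (geometric m) (P *ₚ Q m +ₚ toList (W m)) (division-identity (geometric m)) 1ᵛ) ⟩
      act (geometric m) 1ᵛ                              ≡⟨ act-cong (geometric m) (P *ₚ g) (≈-sym {P *ₚ g} {geometric m} Pg≈G) 1ᵛ ⟩
      act (P *ₚ g) 1ᵛ                                   ≡⟨ act-*ₚ P g 1ᵛ ⟩
      act P (act g 1ᵛ)                                  ≡⟨ P-kills _ ⟩
      0ᵛ                                                ∎

    quotient-unique : ∀ m g → P *ₚ g ≈ geometric m → g ≈ Q m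
    quotient-unique m g Pg≈G = monic-*ₚ-cancelˡ P k (coef-monic-top c) (coef-monic> c) g (Q m)
      (≈-trans {P *ₚ g} {geometric m} {P *ₚ Q m} Pg≈G
               (≈-sym {P *ₚ Q m} {geometric m} (remainder-zero⇒divides m (divides⇒remainder-zero m g Pg≈G))))

    remainder-zero⇒return : ∀ m → W m ≡ 0ᵛ → αPower m ≡ 1ᵛ
    remainder-zero⇒return m W≡0 = begin
      αPower m                  ≡⟨ sym (𝕽.⊕-idˡ (αPower m)) ⟩
      0ᵛ +ᵛ αPower m            ≡⟨ cong (_+ᵛ αPower m) (sym W≡0) ⟩
      W m +ᵛ αPower m           ≡⟨ sym (remainder-step m) ⟩
      mulX (W m) +ᵛ 1ᵛ          ≡⟨ cong (λ z → mulX z +ᵛ 1ᵛ) W≡0 ⟩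
      mulX 0ᵛ +ᵛ 1ᵛ             ≡⟨ cong (_+ᵛ 1ᵛ) T-0 ⟩
      0ᵛ +ᵛ 1ᵛ                  ≡⟨ 𝕽.⊕-idˡ 1ᵛ ⟩
      1ᵛ                        ∎

    -- α ≠ 1, because P(1) ≠ 0: otherwise reduction would not change the value
    -- at 1, forcing top(1ᵛ) = 0; then x·1 would have constant term 0, unlike 1
    α≢1 : mulX 1ᵛ ≢ 1ᵛ
    α≢1 α≡1 = 0≢1 (begin
      0#                                   ≡⟨ sym (+-identityˡ 0#) ⟩
      0# + 0#                              ≡⟨ cong (0# +_) (sym (trans (cong (_* coef P 0) -top≡0) (zeroˡ _))) ⟩
      0# + (- top 1ᵛ) * coef P 0           ≡⟨ sym (entry-mulX 1ᵛ 0) ⟩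
      entry (mulX 1ᵛ) 0                    ≡⟨ cong (λ w → entry w 0) α≡1 ⟩
      entry 1ᵛ 0                           ≡⟨ entry-1ᵛ 0 ⟩
      1#                                   ∎)
      where
      -top*P[1]≡0 : (- top 1ᵛ) * P[1] ≡ 0#
      -top*P[1]≡0 = +-cancelˡ (valueAt1 1ᵛ) _ _ (begin
        valueAt1 1ᵛ + (- top 1ᵛ) * P[1] ≡⟨ sym (valueAt1-mulX 1ᵛ) ⟩
        valueAt1 (mulX 1ᵛ)              ≡⟨ cong valueAt1 α≡1 ⟩
        valueAt1 1ᵛ                     ≡⟨ sym (+-identityʳ _) ⟩
        valueAt1 1ᵛ + 0#                ∎)
      -top≡0 : - top 1ᵛ ≡ 0#
      -top≡0 with (- top 1ᵛ) ≟ 0#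
      ... | yes e = e
      ... | no -top≢0 = ⊥-elim (nonzero-* _ _ -top≢0 P[1]-nonzero -top*P[1]≡0)

    -- ... and conversely: if α^m = 1 then x·W_m = W_m, so W_m kills α - 1 ≠ 0
    -- and vanishes by the annihilator lemma
    return⇒remainder-zero : ∀ m → αPower m ≡ 1ᵛ → W m ≡ 0ᵛ
    return⇒remainder-zero m α^m≡1 = no-small-annihilator residueModule α-1 α-1≢0 (P-kills α-1) (W m) W[α-1]≡0
      where
      α-1 : Coords k
      α-1 = mulX 1ᵛ +ᵛ -ᵛ 1ᵛ
      α-1≢0 : α-1 ≢ 0ᵛ
      α-1≢0 e = α≢1 (difference-zero (mulX 1ᵛ) 1ᵛ e)
      x·W≡W : mulX (W m) ≡ W m
      x·W≡W = +ᵛ-cancelʳ (mulX (W m)) (W m) 1ᵛ (trans (remainder-step m) (cong (W m +ᵛ_) α^m≡1))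
      same-image : mulX 1ᵛ ⊗ W m ≡ 1ᵛ ⊗ W m
      same-image = trans (⊗-mulX 1ᵛ (W m)) (trans (cong mulX (⊗-identityˡ (W m))) (trans x·W≡W (sym (⊗-identityˡ (W m)))))
      W[α-1]≡0 : act (toList (W m)) α-1 ≡ 0ᵛ
      W[α-1]≡0 = trans (⊗-comm (W m) α-1) (EvalAt.ev-difference (W m) (mulX 1ᵛ) 1ᵛ same-image)

    -- R = F[x]/(P) is a field with q^k elements.  Multiplication by x ≠ 0 is
    -- injective (the annihilator lemma applied to x), hence bijective on the
    -- finite set F^k, which provides inverses.
    ⊗-injective : ∀ x → x ≢ 0ᵛ → ∀ y y′ → x ⊗ y ≡ x ⊗ y′ → y ≡ y′
    ⊗-injective x x≢0 y y′ e = difference-zero y y′ (no-small-annihilator residueModule x x≢0 (P-kills x) (y +ᵛ -ᵛ y′)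
      (EvalAt.ev-difference x y y′ (trans (⊗-comm y x) (trans e (⊗-comm x y′)))))

    ⊗-inverse : ∀ x → x ≢ 0ᵛ → ∃ λ y → x ⊗ y ≡ 1ᵛ
    ⊗-inverse x x≢0 with ∈-map⁻ (x ⊗_) (Pigeonhole.⊇ (map (x ⊗_) (vectors k)) (vectors k)
                        (Unique.map⁺ (λ {y} {y′} → ⊗-injective x x≢0 y y′) (vectors-unique k))
                        (λ {v} _ → vectors-complete k v) (Listₚ.length-map (x ⊗_) (vectors k)) (vectors-complete k 1ᵛ))
      where open CountCoords k using (module Pigeonhole)
    ... | y , _ , 1≡xy = y , sym 1≡xy

    isCommutativeRing : IsCommutativeRing _≡_ _+ᵛ_ _⊗_ -ᵛ_ 0ᵛ 1ᵛ
    isCommutativeRing = record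
      { isRing = record
        { +-isAbelianGroup = record
          { isGroup = record
            { isMonoid = record
              { isSemigroup = record
                { isMagma = record { isEquivalence = isEquivalence ; ∙-cong = cong₂ _+ᵛ_ }
                ; assoc = 𝕽.⊕-assoc }
              ; identity = 𝕽.⊕-idˡ , ⊕-idʳ }
            ; inverse = (λ x → entrywise λ i → trans (entry-+ᵛ (-ᵛ x) x i) (trans (cong (_+ entry x i) (entry--ᵛ x i)) (trans (-‿inverseˡ _) (sym (entry-0ᵛ i)))))
                      , (λ x → entrywise λ i → trans (entry-+ᵛ x (-ᵛ x) i) (trans (cong (entry x i +_) (entry--ᵛ x i)) (trans (-‿inverseʳ _) (sym (entry-0ᵛ i)))))
            ; ⁻¹-cong = cong -ᵛ_ }
          ; comm = 𝕽.⊕-comm }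
        ; *-cong = cong₂ _⊗_
        ; *-assoc = ⊗-assoc
        ; *-identity = ⊗-identityˡ , (λ x → trans (⊗-comm x 1ᵛ) (⊗-identityˡ x))
        ; distrib = ⊗-distribˡ , (λ x y z → ⊗-distribʳ y z x) }
      ; *-comm = ⊗-comm }

    residueField : FiniteField (q ℕ.^ k)
    residueField = record
      { Carrier = Coords k ; _+_ = _+ᵛ_ ; _*_ = _⊗_ ; -_ = -ᵛ_ ; 0# = 0ᵛ ; 1# = 1ᵛ
      ; isCommRing = isCommutativeRing
      ; 0≢1 = λ 0≡1 → 0≢1 (trans (sym (entry-0ᵛ 0)) (trans (cong (λ z → entry z 0) 0≡1) (entry-1ᵛ 0)))
      ; inverse = ⊗-inverse
      ; _≟_ = ≡-dec _≟_
      ; card = coords↔Fin k }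

    embed : Carrier → Coords k
    embed a = a ·ᵛ 1ᵛ

    embed-hom : IsFieldHom F residueField embed
    embed-hom = record
      { hom-1 = 𝕽.⊙-one 1ᵛ
      ; hom-+ = λ a b → 𝕽.⊙-distʳ a b 1ᵛ
      ; hom-* = λ a b → trans (𝕽.⊙-assoc a b 1ᵛ) (sym (trans (⊗-·ᵛ a 1ᵛ (embed b)) (cong (a ·ᵛ_) (⊗-identityˡ (embed b))))) }

    α : Coords k
    α = mulX 1ᵛ

    α⊗ : ∀ w → α ⊗ w ≡ mulX w
    α⊗ w = trans (⊗-mulX 1ᵛ w) (cong mulX (⊗-identityˡ w))

    eval-at-α : ∀ f → eval residueField (map embed f) α ≡ act f 1ᵛ
    eval-at-α []      = refl
    eval-at-α (a ∷ f) = cong (a ·ᵛ 1ᵛ +ᵛ_) (trans (α⊗ _) (cong mulX (eval-at-α f)))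

    α-is-root : eval residueField (map embed P) α ≡ 0ᵛ
    α-is-root = trans (eval-at-α P) P-kills-1ᵛ

    pow≡αPower : ∀ j → pow residueField α j ≡ αPower j
    pow≡αPower zero    = refl
    pow≡αPower (suc j) = trans (α⊗ _) (cong mulX (pow≡αPower j))

    -- If α^0, ..., α^(m-1) are distinct and nonzero and F^k has m + 1
    -- elements, these powers are exactly the nonzero vectors, so the number of
    -- j < m with α^j(1) = 1 is the number of vectors with value 1 at 1.
    module CountHits (m : ℕ) (|F^k|≡m+1 : q ℕ.^ k ≡ m ℕ.+ 1)
                     (distinct : ∀ i j → i ℕ.< j → j ℕ.< m → αPower i ≢ αPower j)
                     (nonzero : ∀ i → αPower i ≢ 0ᵛ) where
      open CountCoords k

      powers : ℕ → List (Coords k)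
      powers zero    = []
      powers (suc j) = αPower j ∷ powers j

      count-powers : ∀ {R : Pred (Coords k) 0ℓ} (R? : Decidable R) j → count R? (powers j) ≡ countBelow (λ i → R? (αPower i)) j
      count-powers R? zero = refl
      count-powers R? (suc j) with R? (αPower j)
      ... | yes _ = cong suc (count-powers R? j)
      ... | no  _ = count-powers R? j

      ∈-powers : ∀ {x} j → x ∈ powers j → Σ ℕ λ i → i ℕ.< j × x ≡ αPower i
      ∈-powers (suc j) (here x≡) = j , ℕₚ.n<1+n j , x≡
      ∈-powers (suc j) (there x∈) with ∈-powers j x∈
      ... | i , i<j , x≡ = i , ℕₚ.m<n⇒m<1+n i<j , x≡

      length-powers : ∀ j → length (powers j) ≡ j
      length-powers zero    = refl
      length-powers (suc j) = cong suc (length-powers j)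

      powers-unique : ∀ j → j ℕ.≤ m → Unique (powers j)
      powers-unique zero    _    = AllPairs.[]
      powers-unique (suc j) j<m = All.tabulate (λ {x} x∈ → new x (∈-powers j x∈)) AllPairs.∷ powers-unique j (ℕₚ.<⇒≤ j<m)
        where
        new : ∀ x → (Σ ℕ λ i → i ℕ.< j × x ≡ αPower i) → αPower j ≢ x
        new x (i , i<j , x≡) αʲ≡x = distinct i j i<j j<m (sym (trans αʲ≡x x≡))

      nonzeroVectors : List (Coords k)
      nonzeroVectors = filter (λ v → ¬? (≡-dec _≟_ v 0ᵛ)) (vectors k)

      powers⊆nonzero : ∀ {x} → x ∈ powers m → x ∈ nonzeroVectors
      powers⊆nonzero {x} x∈ with ∈-powers m x∈
      ... | i , _ , x≡ = ∈-filter⁺ (λ v → ¬? (≡-dec _≟_ v 0ᵛ)) (vectors-complete k x) (λ x≡0 → nonzero i (trans (sym x≡) x≡0))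

      length-nonzero : length nonzeroVectors ≡ m
      length-nonzero = ℕₚ.+-cancelˡ-≡ 1 _ _ (begin
        1 ℕ.+ length nonzeroVectors                                ≡⟨ cong (ℕ._+ length nonzeroVectors)
                                                                        (sym (count-once 0ᵛ (vectors k) (vectors-unique k) (vectors-complete k 0ᵛ))) ⟩
        count (λ v → ≡-dec _≟_ v 0ᵛ) (vectors k) ℕ.+ length nonzeroVectors ≡⟨ sym (count-split (λ v → ≡-dec _≟_ v 0ᵛ) (vectors k)) ⟩
        length (vectors k)                                          ≡⟨ vectors-length k ⟩
        q ℕ.^ k                                                     ≡⟨ trans |F^k|≡m+1 (ℕₚ.+-comm m 1) ⟩
        1 ℕ.+ m                                                     ∎)

      Hit-vector? : Decidable (λ (v : Coords k) → valueAt1 v ≡ 1#)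
      Hit-vector? v = valueAt1 v ≟ 1#

      count-hits : countBelow Hit? m ≡ q ℕ.^ k′
      count-hits = begin
        countBelow Hit? m                          ≡⟨ sym (count-powers Hit-vector? m) ⟩
        count Hit-vector? (powers m)               ≡⟨ Pigeonhole.count-≡ (powers m) nonzeroVectors (powers-unique m ℕₚ.≤-refl) powers⊆nonzero
                                                                         (trans (length-powers m) (sym length-nonzero)) Hit-vector? ⟩
        count Hit-vector? nonzeroVectors           ≡⟨ count-filter Hit-vector? (λ v → ¬? (≡-dec _≟_ v 0ᵛ))
                                                                   (λ v hit v≡0 → 0≢1 (trans (sym valueAt1-0ᵛ) (trans (cong valueAt1 (sym v≡0)) hit)))
                                                                   (vectors k) ⟩
        count Hit-vector? (vectors k)              ≡⟨ count-valueAt1 k′ 1# ⟩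
        q ℕ.^ k′                                   ∎

    -- Any field E ⊇ F containing a root αE of P receives R by v ↦ v(αE); by the
    -- annihilator lemma (applied in E, with x acting as αE) this is injective.
    -- So an order of αE transfers to α.
    module FromExtension {r} (E : FiniteField r) (ιE : Carrier → FiniteField.Carrier E) (hom : IsFieldHom F E ιE)
                         (αE : FiniteField.Carrier E) (root : eval E (map ιE P) αE ≡ FiniteField.0# E) where
      private
        module E = FieldFacts E
        module ι = IsFieldHom hom

      ι-0 : ιE 0# ≡ E.0#
      ι-0 = E.x+x≈x⇒x≈0 _ (trans (sym (ι.hom-+ 0# 0#)) (cong ιE (+-identityˡ 0#)))

      extensionModule : FxModule
      extensionModule = record
        { M = E.Carrier ; _⊕_ = E._+_ ; 0ᴹ = E.0# ; _⊙_ = λ a w → ιE a E.* w ; T = αE E.*_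
        ; ⊕-assoc = E.+-assoc ; ⊕-comm = E.+-comm ; ⊕-idˡ = E.+-identityˡ
        ; ⊙-distˡ = λ a x y → E.distribˡ (ιE a) x y
        ; ⊙-distʳ = λ a b x → trans (cong (E._* x) (ι.hom-+ a b)) (E.distribʳ x (ιE a) (ιE b))
        ; ⊙-assoc = λ a b x → trans (cong (E._* x) (ι.hom-* a b)) (E.*-assoc (ιE a) (ιE b) x)
        ; ⊙-one = λ x → trans (cong (E._* x) ι.hom-1) (E.*-identityˡ x)
        ; ⊙-zero = λ x → trans (cong (E._* x) ι-0) (E.zeroˡ x)
        ; T-⊕ = E.distribˡ αE
        ; T-⊙ = λ a x → trans (sym (E.*-assoc αE (ιE a) x)) (trans (cong (E._* x) (E.*-comm αE (ιE a))) (E.*-assoc (ιE a) αE x)) }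
      private module 𝔼 = FxModuleTheory extensionModule

      act-extension : ∀ f w → 𝔼.act f w ≡ eval E (map ιE f) αE E.* w
      act-extension []      w = sym (E.zeroˡ w)
      act-extension (a ∷ f) w = trans (cong (λ z → ιE a E.* w E.+ αE E.* z) (act-extension f w))
        (trans (cong (ιE a E.* w E.+_) (sym (E.*-assoc αE _ w))) (sym (E.distribʳ w (ιE a) _)))

      P-kills-1 : 𝔼.act P E.1# ≡ E.0#
      P-kills-1 = trans (act-extension P E.1#) (trans (cong (E._* E.1#) root) (E.zeroˡ _))

      open Evaluation extensionModule E.1# P-kills-1 using (ev; ev-1ᵛ; ev-0ᵛ; ev-mulX; ev-difference)

      ev-αPower : ∀ j → ev (αPower j) ≡ pow E αE j
      ev-αPower zero    = ev-1ᵛ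
      ev-αPower (suc j) = trans (ev-mulX (αPower j)) (cong (αE E.*_) (ev-αPower j))

      ev-injective : ∀ v w → ev v ≡ ev w → v ≡ w
      ev-injective v w e = difference-zero v w (no-small-annihilator extensionModule E.1# E.1≢0 P-kills-1 (v +ᵛ -ᵛ w) (ev-difference v w e))

      module WithOrder (m : ℕ) (1≤m : 1 ℕ.≤ m) (order : HasOrder E αE m) where
        powE : ℕ → E.Carrier
        powE = pow E αE

        α^m≡1 : αPower m ≡ 1ᵛ
        α^m≡1 = ev-injective (αPower m) 1ᵛ (trans (ev-αPower m) (trans (proj₁ order) (sym ev-1ᵛ)))

        αE≢0 : αE ≢ E.0#
        αE≢0 αE≡0 = E.0≢1 (trans (sym (positive-power-zero m 1≤m)) (proj₁ order))
          where
          positive-power-zero : ∀ j → 1 ℕ.≤ j → powE j ≡ E.0#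
          positive-power-zero (suc j) _ = trans (cong (E._* powE j) αE≡0) (E.zeroˡ _)

        powE≢0 : ∀ j → powE j ≢ E.0#
        powE≢0 zero    = E.1≢0
        powE≢0 (suc j) = E.nonzero-* αE (powE j) αE≢0 (powE≢0 j)

        powE-+ : ∀ a b → powE (a ℕ.+ b) ≡ powE a E.* powE b
        powE-+ zero    b = sym (E.*-identityˡ _)
        powE-+ (suc a) b = trans (cong (αE E.*_) (powE-+ a b)) (sym (E.*-assoc αE (powE a) (powE b)))

        -- α^i = α^j with i < j < m would give αE^(j-i) = 1 below the order
        distinct : ∀ i j → i ℕ.< j → j ℕ.< m → αPower i ≢ αPower j
        distinct i j i<j j<m αⁱ≡αʲ = proj₂ order (j ℕ.∸ i) (ℕₚ.m<n⇒0<n∸m i<j) (ℕₚ.≤-<-trans (ℕₚ.m∸n≤m j i) j<m) (sym 1≡)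
          where
          1≡ : E.1# ≡ powE (j ℕ.∸ i)
          1≡ = E.*-cancelˡ (powE i) E.1# (powE (j ℕ.∸ i)) (powE≢0 i) (begin
            powE i E.* E.1#               ≡⟨ E.*-identityʳ _ ⟩
            powE i                        ≡⟨ trans (sym (ev-αPower i)) (trans (cong ev αⁱ≡αʲ) (ev-αPower j)) ⟩
            powE j                        ≡⟨ cong powE (sym (ℕₚ.m+[n∸m]≡n (ℕₚ.<⇒≤ i<j))) ⟩
            powE (i ℕ.+ (j ℕ.∸ i))        ≡⟨ powE-+ i (j ℕ.∸ i) ⟩
            powE i E.* powE (j ℕ.∸ i)     ∎)

        nonzero : ∀ i → αPower i ≢ 0ᵛ
        nonzero i αⁱ≡0 = powE≢0 i (trans (sym (ev-αPower i)) (trans (cong ev αⁱ≡0) ev-0ᵛ))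

    module Directions (2≤q : 2 ℕ.≤ q) where
      open PowerArithmetic q k′ 2≤q

      target : ℕ
      target = (q ℕ.∸ 1) ℕ.* q ℕ.^ k′ ℕ.∸ 1

      QuotientCondition : Set
      QuotientCondition = Σ (Poly F) λ g → x-1 F *ₚ (P *ₚ g) ≈ xᵐ-1 F m × weight F g ≡ target

      Miss? : ∀ i → Dec (valueAt1 (αPower i) ≢ 1#)
      Miss? i = ¬? (Hit? i)

      -- hits and misses below m add up to m, and target = m - q^(k-1)
      hits⇒misses : countBelow Hit? m ≡ q ℕ.^ k′ → countBelow Miss? m ≡ target
      hits⇒misses hits = begin
        countBelow Miss? m                                       ≡⟨ sym (ℕₚ.m+n∸m≡n (countBelow Hit? m) (countBelow Miss? m)) ⟩
        countBelow Hit? m ℕ.+ countBelow Miss? m ℕ.∸ countBelow Hit? m ≡⟨ cong₂ ℕ._∸_ (countBelow-split Hit? m) hits ⟩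
        m ℕ.∸ q ℕ.^ k′                                           ≡⟨ sym target≡ ⟩
        target                                                   ∎

      misses⇒hits : countBelow Miss? m ≡ target → countBelow Hit? m ≡ q ℕ.^ k′
      misses⇒hits misses = begin
        countBelow Hit? m                                        ≡⟨ sym (ℕₚ.m+n∸n≡m (countBelow Hit? m) (countBelow Miss? m)) ⟩
        countBelow Hit? m ℕ.+ countBelow Miss? m ℕ.∸ countBelow Miss? m ≡⟨ cong₂ ℕ._∸_ (countBelow-split Hit? m) (trans misses target≡) ⟩
        m ℕ.∸ (m ℕ.∸ q ℕ.^ k′)                                   ≡⟨ ℕₚ.m∸[m∸n]≡n q^k′≤m ⟩
        q ℕ.^ k′                                                 ∎

      primitive⇒quotient : Primitive F k P → QuotientCondition
      primitive⇒quotient (_ , _ , E , ιE , hom , αE , root , order) = Q m , divides , weight≡target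
        where
        open FromExtension E ιE hom αE root
        open WithOrder m 1≤m order
        W≡0 : W m ≡ 0ᵛ
        W≡0 = return⇒remainder-zero m α^m≡1
        divides : x-1 F *ₚ (P *ₚ Q m) ≈ xᵐ-1 F m
        divides = ≈-trans {x-1 F *ₚ (P *ₚ Q m)} {x-1 F *ₚ geometric m} {xᵐ-1 F m}
                          (*ₚ-congʳ (x-1 F) {P *ₚ Q m} {geometric m} (remainder-zero⇒divides m W≡0)) ([x-1]*geometric m 1≤m)
        weight≡target : weight F (Q m) ≡ target
        weight≡target = trans (weight-Q m)
          (hits⇒misses (CountHits.count-hits m (sym m+1≡q^k) distinct nonzero))

      -- α has order m when α^m = 1 and exactly q^(k-1) hits lie below m: the
      -- first return d divides m, the hits below m are (m/d) times those below
      -- d, so m/d divides q^(k-1) and m, hence m/d = 1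
      no-early-return : αPower m ≡ 1ᵛ → countBelow Hit? m ≡ q ℕ.^ k′ → NoReturnBelow m
      no-early-return α^m≡1 hits j 1≤j j<m αʲ≡1 with first-return (λ i → ≡-dec _≟_ (αPower i) 1ᵛ) (suc j)
      ... | inj₁ none = none j 1≤j (ℕₚ.n<1+n j) αʲ≡1
      ... | inj₂ (d , 1≤d , d<sj , αᵈ≡1 , first) = ℕₚ.<-irrefl (sym m≡d) (ℕₚ.≤-<-trans (ℕₚ.≤-pred d<sj) j<m)
        where
        open Period {d} αᵈ≡1 using (periodic)
        t = proj₁ (first-return-divides d 1≤d αᵈ≡1 first m α^m≡1)
        m≡td : m ≡ t ℕ.* d
        m≡td = proj₂ (first-return-divides d 1≤d αᵈ≡1 first m α^m≡1)
        hits-periodic : countBelow Hit? m ≡ t ℕ.* countBelow Hit? d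
        hits-periodic = trans (cong (countBelow Hit?) m≡td)
          (countBelow-periodic Hit? d (λ i hit → trans (cong valueAt1 (periodic i)) hit)
                                      (λ i hit → trans (cong valueAt1 (sym (periodic i))) hit) t)
        t∣q^k′ : t ℕ.∣ q ℕ.^ k′
        t∣q^k′ = ℕ.divides (countBelow Hit? d) (trans (sym hits) (trans hits-periodic (ℕₚ.*-comm t _)))
        t≡1 : t ≡ 1
        t≡1 = common-divisor≡1 t t∣q^k′ (ℕ.divides d (trans m≡td (ℕₚ.*-comm t d)))
        m≡d : m ≡ d
        m≡d = trans m≡td (trans (cong (ℕ._* d) t≡1) (ℕₚ.+-identityʳ d))

      -- (⇐) such a g is the quotient Q_m, so α^m = 1 and the hits below m number
      -- q^(k-1); then α, a root of P in the field R, has order m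
      quotient⇒primitive : QuotientCondition → Primitive F k P
      quotient⇒primitive (g , [x-1]Pg≈xᵐ-1 , weight≡target) =
        irreducible , P[0]≢0 , residueField , embed , embed-hom , α , α-is-root ,
        (trans (pow≡αPower m) α^m≡1 , λ j 1≤j j<m αʲ≡1 → no-early-return α^m≡1 hits j 1≤j j<m (trans (sym (pow≡αPower j)) αʲ≡1))
        where
        Pg≈G : P *ₚ g ≈ geometric m
        Pg≈G = [x-1]*h≈xᵐ-1⇒h≈geometric m 1≤m (P *ₚ g) [x-1]Pg≈xᵐ-1
        α^m≡1 : αPower m ≡ 1ᵛ
        α^m≡1 = remainder-zero⇒return m (divides⇒remainder-zero m g Pg≈G)
        hits : countBelow Hit? m ≡ q ℕ.^ k′
        hits = misses⇒hits (trans (sym (weight-Q m)) (trans (weight-cong (Q m) g (≈-sym {g} {Q m} (quotient-unique m g Pg≈G))) weight≡target))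
        -- P(0)·g(0) = G_m(0) = 1
        P[0]≢0 : coef P 0 ≢ 0#
        P[0]≢0 P[0]≡0 = 0≢1 (begin
          0#                      ≡⟨ sym (zeroˡ _) ⟩
          0# * coef g 0           ≡⟨ cong (_* coef g 0) (sym P[0]≡0) ⟩
          coef P 0 * coef g 0     ≡⟨ sym (coef-*-0 P g) ⟩
          coef (P *ₚ g) 0         ≡⟨ Pg≈G 0 ⟩
          coef (geometric m) 0    ≡⟨ coef-geometric< m 0 1≤m ⟩
          1#                      ∎)

open import Data.Nat using (_≤_; _^_; _∸_; _*_)

prime-power≥2 : ∀ q → IsPrimePower q → 2 ≤ q
prime-power≥2 q (ℓ , suc e , ℓ-prime , _ , refl) = ℕₚ.*-mono-≤ 2≤ℓ (1≤ℓ^ e)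
  where
  2≤ℓ : 2 ≤ ℓ
  2≤ℓ = ℕ.nonTrivial⇒n>1 ℓ {{prime⇒nonTrivial ℓ-prime}}
  1≤ℓ^ : ∀ n → 1 ≤ ℓ ^ n
  1≤ℓ^ zero    = ℕₚ.≤-refl
  1≤ℓ^ (suc n) = ℕₚ.*-mono-≤ (ℕₚ.≤-trans (s≤s z≤n) 2≤ℓ) (1≤ℓ^ n)

theorem1 : (q : ℕ) → IsPrimePower q → (F : FiniteField q) → (k : ℕ) → 1 ≤ k →
           (c : Vec (FiniteField.Carrier F) k) →
           Irreducible F (monicPoly F c) →
           eval F (monicPoly F c) (FiniteField.1# F) ≢ FiniteField.0# F →
           Primitive F k (monicPoly F c)
             ⇔ Σ (Poly F) (λ g →
                  _≈P_ F (mulP F (x-1 F) (mulP F (monicPoly F c) g)) (xᵐ-1 F (q ^ k ∸ 1))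
                  × weight F g ≡ (q ∸ 1) * q ^ (k ∸ 1) ∸ 1)
theorem1 q q-prime-power F (suc k′) _ c irreducible P[1]≢0 = mk⇔ primitive⇒quotient quotient⇒primitive
  where
  open OverField.Primitivity F k′ c irreducible P[1]≢0
  open Directions (prime-power≥2 q q-prime-power)
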